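{- Let $\alpha,\lambda\in\mathbb{C}$ and let $\ell,n,r,s$ be nonnegative integers. Then the following identity holds in $\mathbb{C}[x]$: \begin{align*} &\sum_{k=0}^{n+r}\lambda^{n+r-k}\binom{n+r}{k}\binom{\ell+k+r}{r}B_{\ell+k}^{(\alpha)}(x) +(-1)^{\ell+n+r+1}\sum_{k=0}^{\ell+r}\lambda^{\ell+r-k}\binom{\ell+r}{k}\binom{n+k+r}{r}B_{n+k}^{(\alpha)}(\alpha+s-\lambda-x)\\ &\qquad=\Omega_{\alpha-1}\left(\frac{D^{r+1}}{r!}\sum_{k=1}^{s}(x-k)^{\ell+r}(x+\lambda-k)^{n+r}\right). \end{align*}
   Context: For $\alpha\in\mathbb{C}$, the generalized Bernoulli polynomials $B_n^{(\alpha)}(x)$ are defined by $\sum_{n\ge0}B_n^{(\alpha)}(x)\frac{t^n}{n!}=\left(\frac{t}{e^t-1}\right)^{\alpha}e^{tx}$ (formal power series in $t$, where $\left(\frac{t}{e^t-1}\right)^{\alpha}$ is the power series with constant term $1$). $D$ denotes the derivative operator on $\mathbb{C}[x]$. For $\gamma\in\mathbb{C}$, $\Omega_\gamma$ denotes the $\mathbb{C}$-linear endomorphism of $\mathbb{C}[x]$ defined by $\Omega_\gamma(x^n)=B_n^{(\gamma)}(x)$ for all $n\ge 0$. An empty sum (e.g. $s=0$) is $0$. -}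

module Defs where

open import Level using (Level; suc; _⊔_)
open import Algebra.Bundles using (CommutativeRing)
open import Data.Nat using (ℕ; zero; _∸_) renaming (suc to sucℕ; _+_ to _+ℕ_)
open import Data.Nat.Combinatorics using (_C_)
open import Data.Nat using (_!)
open import Data.List using (List; []; _∷_; length)
open import Relation.Nullary using (¬_)

natIn : ∀ {c ℓ} (R : CommutativeRing c ℓ) → ℕ → CommutativeRing.Carrier R
natIn R zero = CommutativeRing.0# R
natIn R (sucℕ n) = CommutativeRing._+_ R (CommutativeRing.1# R) (natIn R n)

-- A field of characteristic zero (the role played by ℂ in the paper):
-- a commutative ring with inverses of nonzero elements and n·1 ≠ 0 for n ≥ 1.
record CharZeroField (c ℓ : Level) : Set (Level.suc (c ⊔ ℓ)) where
  field
    commRing : CommutativeRing c ℓ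
  open CommutativeRing commRing public
  field
    _⁻¹      : Carrier → Carrier
    inverseʳ : ∀ x → ¬ (x ≈ 0#) → (x * (x ⁻¹)) ≈ 1#
    char0    : ∀ n → ¬ (natIn commRing (sucℕ n) ≈ 0#)

module WithField {c ℓ : Level} (F : CharZeroField c ℓ) where
  open CharZeroField F

  nat : ℕ → Carrier
  nat n = natIn commRing n

  invℕ : ℕ → Carrier
  invℕ n = (nat n) ⁻¹

  pow : Carrier → ℕ → Carrier
  pow a zero = 1#
  pow a (sucℕ m) = a * pow a m

  sumBelow : ℕ → (ℕ → Carrier) → Carrier
  sumBelow zero f = 0#
  sumBelow (sucℕ n) f = sumBelow n f + f n

  -- Formal power series in t, as coefficient functions ℕ → Carrier
  Series : Set c
  Series = ℕ → Carrier

  _⋆_ : Series → Series → Series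
  (f ⋆ g) n = sumBelow (sucℕ n) (λ i → f i * g (n ∸ i))

  powS : Series → ℕ → Series
  powS f zero zero = 1#
  powS f zero (sucℕ _) = 0#
  powS f (sucℕ j) = f ⋆ powS f j

  oneS : Series
  oneS zero = 1#
  oneS (sucℕ _) = 0#

  -- (e^t - 1)/t = Σ_m t^m/(m+1)!
  expm1OverT : Series
  expm1OverT m = invℕ ((sucℕ m) !)

  -- reciprocal of a series g with constant term 1: 1/g = Σ_j (1 - g)^j
  -- (coefficient of t^n only involves j ≤ n)
  recipS : Series → Series
  recipS g n = sumBelow (sucℕ n) (λ j → powS (λ m → oneS m - g m) j n)

  todd : Series
  todd = recipS expm1OverT

  fallingFact : Carrier → ℕ → Carrier
  fallingFact a zero = 1#
  fallingFact a (sucℕ j) = fallingFact a j * (a - nat j)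

  binomC : Carrier → ℕ → Carrier
  binomC a j = fallingFact a j * invℕ (j !)

  -- a-th power of a series h with constant term 1: Σ_j binom(a,j) (h - 1)^j
  powerC : Series → Carrier → Series
  powerC h a n = sumBelow (sucℕ n) (λ j → binomC a j * powS (λ m → h m - oneS m) j n)

  toddPow : Carrier → Series
  toddPow a = powerC todd a

  -- Polynomials in x: coefficient lists (lowest degree first)
  Poly : Set c
  Poly = List Carrier

  coeff : Poly → ℕ → Carrier
  coeff [] i = 0#
  coeff (a ∷ p) zero = a
  coeff (a ∷ p) (sucℕ i) = coeff p i

  _≈ₚ_ : Poly → Poly → Set ℓ
  p ≈ₚ q = ∀ i → coeff p i ≈ coeff q i

  infix 4 _≈ₚ_

  _+ₚ_ : Poly → Poly → Poly
  [] +ₚ q = q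
  (a ∷ p) +ₚ [] = a ∷ p
  (a ∷ p) +ₚ (b ∷ q) = (a + b) ∷ (p +ₚ q)

  scale : Carrier → Poly → Poly
  scale c [] = []
  scale c (a ∷ p) = (c * a) ∷ scale c p

  constP : Carrier → Poly
  constP a = a ∷ []

  X : Poly
  X = 0# ∷ 1# ∷ []

  _*ₚ_ : Poly → Poly → Poly
  [] *ₚ q = []
  (a ∷ p) *ₚ q = scale a q +ₚ (0# ∷ (p *ₚ q))

  powP : Poly → ℕ → Poly
  powP p zero = constP 1#
  powP p (sucℕ m) = p *ₚ powP p m

  monomial : ℕ → Poly
  monomial m = powP X m

  sumBelowP : ℕ → (ℕ → Poly) → Poly
  sumBelowP zero f = []
  sumBelowP (sucℕ n) f = sumBelowP n f +ₚ f n

  derivAux : ℕ → Poly → Poly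
  derivAux k [] = []
  derivAux k (a ∷ p) = (nat k * a) ∷ derivAux (sucℕ k) p

  D : Poly → Poly
  D [] = []
  D (a ∷ p) = derivAux 1 p

  Dpow : ℕ → Poly → Poly
  Dpow zero p = p
  Dpow (sucℕ m) p = D (Dpow m p)

  compose : Poly → Poly → Poly
  compose p q = sumBelowP (length p) (λ i → scale (coeff p i) (powP q i))

  -- Generalized Bernoulli polynomial B_n^{(a)}(x):
  -- n! · [t^n] (t/(e^t-1))^a e^{tx} = n! Σ_{k=0}^n [t^k](t/(e^t-1))^a · x^{n-k}/(n-k)!
  bernoulliGen : Carrier → ℕ → Poly
  bernoulliGen a n =
    scale (nat (n !))
      (sumBelowP (sucℕ n) (λ k → scale (toddPow a k * invℕ ((n ∸ k) !)) (monomial (n ∸ k))))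

  Ω : Carrier → Poly → Poly
  Ω γ p = sumBelowP (length p) (λ i → scale (coeff p i) (bernoulliGen γ i))

  lhs : (α lam : Carrier) (l n r s : ℕ) → Poly
  lhs α lam l n r s =
    sumBelowP (sucℕ (n +ℕ r)) (λ k →
      scale (pow lam ((n +ℕ r) ∸ k) * (nat ((n +ℕ r) C k) * nat ((l +ℕ k +ℕ r) C r)))
            (bernoulliGen α (l +ℕ k)))
    +ₚ
    scale (pow (- 1#) (l +ℕ n +ℕ r +ℕ 1))
      (sumBelowP (sucℕ (l +ℕ r)) (λ k →
        scale (pow lam ((l +ℕ r) ∸ k) * (nat ((l +ℕ r) C k) * nat ((n +ℕ k +ℕ r) C r)))
              (compose (bernoulliGen α (n +ℕ k))
                       (constP (α + nat s - lam) +ₚ scale (- 1#) X))))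

  rhs : (α lam : Carrier) (l n r s : ℕ) → Poly
  rhs α lam l n r s =
    Ω (α - 1#)
      (scale (invℕ (r !))
        (Dpow (sucℕ r)
          (sumBelowP s (λ j →
            powP (X +ₚ constP (- nat (sucℕ j))) (l +ℕ r)
            *ₚ powP (X +ₚ constP (lam - nat (sucℕ j))) (n +ℕ r)))))

module Submission where

-- Everything is translated into formal power series over the field F;
-- a polynomial is read as the series of its coefficients (finite support).
-- For a series φ = Σ φₖ tᵏ, the differential operator φ(D) = Σₖ φₖ Dᵏ acts on
-- polynomials, and composing such operators multiplies their symbols
-- (OP-comp).  By definition Bₙ^(γ)(x) = T^γ(D) xⁿ with T = t/(eᵗ - 1), so
-- Ω_γ = T^γ(D) (Ω-as-operator), and Taylor's formula says p(x + a) = e^{aD} p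
-- (taylor).  Two power-series identities for P_a = T^a carry the argument:
-- P_a · (eᵗ - 1)/t = P_{a-1} (P-shift) and P_a(-t) = e^{at} P_a(t)
-- (P-reflection); both follow from the linear ODE P_a' = a (T'/T) P_a and
-- uniqueness of solutions of such ODEs (ode-unique).
--
-- With H = (1/r!) Dʳ (x^{l+r} (x+λ)^{n+r}) and Xⱼ = H(x - j) = e^{-jD} H:
--  * the first sum of the left side is T^α(D) H (D-lemma expands H);
--  * the right side is T^{α-1}(D) D (X₁ + … + Xₛ) = T^α(D) (e^D - 1) (X₁ + … + Xₛ)
--    by P-shift, and since e^D Xⱼ₊₁ = Xⱼ this telescopes to T^α(D) (H - Xₛ);
--  * the second sum of the left side is, by P-reflection and Taylor's formula,
--    -T^α(D) Xₛ.

open import Defs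
open import Level using (Level)
open import Data.Nat using (ℕ)

open import Algebra.Bundles using (CommutativeRing; RawRing)
open import Data.Nat as ℕ using (zero; suc; _∸_; z≤n; s≤s; _!)
import Data.Nat.Properties as ℕₚ
open import Data.Nat.Combinatorics using (_C_; nCk+nC[k+1]≡[n+1]C[k+1]; k![n∸k]!∣n!)
import Data.Nat.Combinatorics.Specification as Combinatorics
open import Data.Nat.DivMod using (m/n*n≡m)
open import Data.Integer as ℤ using (ℤ; +_; -[1+_])
import Data.Integer.Properties as ℤₚ
open import Data.Sign as Sign using (Sign)
open import Data.Product using (_,_)
import Algebra.Properties.Group as GroupProperties
open import Data.Maybe using (just; nothing)
open import Data.Empty using (⊥-elim)
open import Data.List using ([]; _∷_; length)
open import Relation.Binary.PropositionalEquality as ≡ using (_≡_)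
open import Relation.Binary.Definitions using (WeaklyDecidable)
open import Relation.Nullary using (¬_; Dec; yes; no)


module FallingFactorial where

  fallN : ℕ → ℕ → ℕ
  fallN i zero = 1
  fallN i (suc k) = fallN i k ℕ.* (i ∸ k)

  ∸-suc : ∀ i k → k ℕ.< i → i ∸ k ≡ suc (i ∸ suc k)
  ∸-suc (suc i) zero _ = ≡.refl
  ∸-suc (suc i) (suc k) (s≤s lt) = ∸-suc i k lt

  fall-fact : ∀ m r → r ℕ.≤ m → fallN m r ℕ.* (m ∸ r) ! ≡ m !
  fall-fact m zero _ = ℕₚ.+-identityʳ (m !)
  fall-fact m (suc r) lt = begin
    fallN m r ℕ.* (m ∸ r) ℕ.* (m ∸ suc r) ! ≡⟨ ℕₚ.*-assoc (fallN m r) (m ∸ r) _ ⟩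
    fallN m r ℕ.* ((m ∸ r) ℕ.* (m ∸ suc r) !) ≡⟨ ≡.cong (λ z → fallN m r ℕ.* (z ℕ.* (m ∸ suc r) !)) (∸-suc m r lt) ⟩
    fallN m r ℕ.* (suc (m ∸ suc r) !) ≡⟨ ≡.cong (λ z → fallN m r ℕ.* (z !)) (≡.sym (∸-suc m r lt)) ⟩
    fallN m r ℕ.* (m ∸ r) ! ≡⟨ fall-fact m r (ℕₚ.<⇒≤ lt) ⟩
    m ! ∎
    where open ≡.≡-Reasoning

  -- the falling factorial vanishes once it passes through the factor 0
  fall-zero : ∀ m r → m ℕ.< r → fallN m r ≡ 0
  fall-zero m (suc r) (s≤s le) with m ℕ.≟ r
  ... | yes ≡.refl = ≡.trans (≡.cong (fallN m m ℕ.*_) (ℕₚ.n∸n≡0 m)) (ℕₚ.*-zeroʳ (fallN m m))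
  ... | no ne = ≡.cong (ℕ._* (m ∸ r)) (fall-zero m r (ℕₚ.≤∧≢⇒< le ne))

  C-fall : ∀ m r → (m C r) ℕ.* (r !) ≡ fallN m r
  C-fall m r with r ℕ.≤? m
  ... | no r≰m = ≡.trans (≡.cong (ℕ._* r !) (Combinatorics.k>n⇒nCk≡0 (ℕₚ.≰⇒> r≰m))) (≡.sym (fall-zero m r (ℕₚ.≰⇒> r≰m)))
  ... | yes r≤m = ℕₚ.*-cancelʳ-≡ _ _ ((m ∸ r) !) {{ℕₚ._!≢0 (m ∸ r)}} (begin
      (m C r) ℕ.* (r !) ℕ.* (m ∸ r) ! ≡⟨ ℕₚ.*-assoc (m C r) (r !) ((m ∸ r) !) ⟩
      (m C r) ℕ.* (r ! ℕ.* (m ∸ r) !) ≡⟨ ≡.cong (ℕ._* (r ! ℕ.* (m ∸ r) !)) (Combinatorics.nCk≡n!/k![n-k]! r≤m) ⟩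
      (m ! ℕ./ (r ! ℕ.* (m ∸ r) !)) {{nz}} ℕ.* (r ! ℕ.* (m ∸ r) !) ≡⟨ m/n*n≡m {{nz}} (k![n∸k]!∣n! r≤m) ⟩
      m ! ≡⟨ ≡.sym (fall-fact m r r≤m) ⟩
      fallN m r ℕ.* (m ∸ r) ! ∎)
    where
    open ≡.≡-Reasoning
    nz : ℕ.NonZero (r ! ℕ.* (m ∸ r) !)
    nz = ℕₚ.m*n≢0 (r !) ((m ∸ r) !) {{ℕₚ._!≢0 r}} {{ℕₚ._!≢0 (m ∸ r)}}


module IntegerSolver {c ℓ} (R : CommutativeRing c ℓ) where
  open import Algebra.Solver.Ring.AlmostCommutativeRing
  open CommutativeRing R
  open import Relation.Binary.Reasoning.Setoid setoid
  open import Algebra.Properties.Ring ring using (-‿involutive; -‿distribˡ-*; -‿distribʳ-*; -‿+-comm; -0#≈0#)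
  open import Algebra.Properties.CommutativeSemigroup *-commutativeSemigroup using (interchange)

  natR : ℕ → Carrier
  natR = natIn R

  nat-+ : ∀ m n → natR (m ℕ.+ n) ≈ natR m + natR n
  nat-+ zero n = sym (+-identityˡ _)
  nat-+ (suc m) n = trans (+-congˡ (nat-+ m n)) (sym (+-assoc _ _ _))

  nat-* : ∀ m n → natR (m ℕ.* n) ≈ natR m * natR n
  nat-* zero n = sym (zeroˡ _)
  nat-* (suc m) n = begin
    natR (n ℕ.+ m ℕ.* n) ≈⟨ nat-+ n (m ℕ.* n) ⟩
    natR n + natR (m ℕ.* n) ≈⟨ +-congˡ (nat-* m n) ⟩
    natR n + natR m * natR n ≈⟨ +-congʳ (sym (*-identityˡ _)) ⟩
    1# * natR n + natR m * natR n ≈⟨ sym (distribʳ _ _ _) ⟩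
    (1# + natR m) * natR n ∎

  nat-cong : ∀ {m n} → m ≡ n → natR m ≈ natR n
  nat-cong ≡.refl = refl

  ⟦_⟧ℤ : ℤ → Carrier
  ⟦ + n ⟧ℤ = natR n
  ⟦ -[1+ n ] ⟧ℤ = - natR (suc n)

  ⊖-hom : ∀ m n → ⟦ m ℤ.⊖ n ⟧ℤ ≈ natR m - natR n
  ⊖-hom m zero = begin
    ⟦ m ℤ.⊖ 0 ⟧ℤ ≡⟨ ≡.cong ⟦_⟧ℤ (ℤₚ.⊖-≥ {m = m} {n = 0} ℕ.z≤n) ⟩
    natR m ≈⟨ sym (+-identityʳ _) ⟩
    natR m + 0# ≈⟨ +-congˡ (sym -0#≈0#) ⟩
    natR m - 0# ∎
  ⊖-hom zero (suc n) = begin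
    ⟦ 0 ℤ.⊖ suc n ⟧ℤ ≡⟨ ≡.cong ⟦_⟧ℤ (ℤₚ.⊖-≤ {m = 0} {n = suc n} ℕ.z≤n) ⟩
    - natR (suc n) ≈⟨ sym (+-identityˡ _) ⟩
    0# - natR (suc n) ∎
  ⊖-hom (suc m) (suc n) = begin
    ⟦ suc m ℤ.⊖ suc n ⟧ℤ ≡⟨ ≡.cong ⟦_⟧ℤ (ℤₚ.[1+m]⊖[1+n]≡m⊖n m n) ⟩
    ⟦ m ℤ.⊖ n ⟧ℤ ≈⟨ ⊖-hom m n ⟩
    natR m - natR n ≈⟨ shift-both ⟩
    (1# + natR m) - (1# + natR n) ∎
    where
    shift-both : natR m - natR n ≈ (1# + natR m) - (1# + natR n)
    shift-both = begin
      natR m + - natR n ≈⟨ sym (+-identityˡ _) ⟩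
      0# + (natR m + - natR n) ≈⟨ +-congʳ (sym (-‿inverseʳ 1#)) ⟩
      (1# + - 1#) + (natR m + - natR n) ≈⟨ +-assoc _ _ _ ⟩
      1# + (- 1# + (natR m + - natR n)) ≈⟨ +-congˡ (sym (+-assoc _ _ _)) ⟩
      1# + ((- 1# + natR m) + - natR n) ≈⟨ +-congˡ (+-congʳ (+-comm _ _)) ⟩
      1# + ((natR m + - 1#) + - natR n) ≈⟨ +-congˡ (+-assoc _ _ _) ⟩
      1# + (natR m + (- 1# + - natR n)) ≈⟨ sym (+-assoc _ _ _) ⟩
      (1# + natR m) + (- 1# + - natR n) ≈⟨ +-congˡ (-‿+-comm _ _) ⟩
      (1# + natR m) + - (1# + natR n) ∎

  sgnC : Sign → Carrier
  sgnC Sign.+ = 1#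
  sgnC Sign.- = - 1#

  ◃-hom : ∀ s n → ⟦ s ℤ.◃ n ⟧ℤ ≈ sgnC s * natR n
  ◃-hom Sign.+ zero = sym (zeroʳ _)
  ◃-hom Sign.- zero = sym (zeroʳ _)
  ◃-hom Sign.+ (suc n) = sym (*-identityˡ _)
  ◃-hom Sign.- (suc n) = trans (-‿cong (sym (*-identityˡ _))) (-‿distribˡ-* _ _)

  sa-hom : ∀ i → ⟦ i ⟧ℤ ≈ sgnC (ℤ.sign i) * natR ℤ.∣ i ∣
  sa-hom (+ n) = sym (*-identityˡ _)
  sa-hom -[1+ n ] = trans (-‿cong (sym (*-identityˡ _))) (-‿distribˡ-* _ _)

  sgn-* : ∀ s t → sgnC (s Sign.* t) ≈ sgnC s * sgnC t
  sgn-* Sign.+ Sign.+ = sym (*-identityˡ _)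
  sgn-* Sign.+ Sign.- = sym (*-identityˡ _)
  sgn-* Sign.- Sign.+ = sym (*-identityʳ _)
  sgn-* Sign.- Sign.- = begin
    1# ≈⟨ sym (-‿involutive _) ⟩
    - (- 1#) ≈⟨ -‿cong (sym (*-identityʳ _)) ⟩
    - (- 1# * 1#) ≈⟨ -‿distribʳ-* _ _ ⟩
    - 1# * - 1# ∎

  *-hom : ∀ i j → ⟦ i ℤ.* j ⟧ℤ ≈ ⟦ i ⟧ℤ * ⟦ j ⟧ℤ
  *-hom i j = begin
    ⟦ (ℤ.sign i Sign.* ℤ.sign j) ℤ.◃ (ℤ.∣ i ∣ ℕ.* ℤ.∣ j ∣) ⟧ℤ ≈⟨ ◃-hom (ℤ.sign i Sign.* ℤ.sign j) (ℤ.∣ i ∣ ℕ.* ℤ.∣ j ∣) ⟩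
    sgnC (ℤ.sign i Sign.* ℤ.sign j) * natR (ℤ.∣ i ∣ ℕ.* ℤ.∣ j ∣) ≈⟨ *-cong (sgn-* (ℤ.sign i) (ℤ.sign j)) (nat-* ℤ.∣ i ∣ ℤ.∣ j ∣) ⟩
    (sgnC (ℤ.sign i) * sgnC (ℤ.sign j)) * (natR ℤ.∣ i ∣ * natR ℤ.∣ j ∣) ≈⟨ interchange _ _ _ _ ⟩
    (sgnC (ℤ.sign i) * natR ℤ.∣ i ∣) * (sgnC (ℤ.sign j) * natR ℤ.∣ j ∣) ≈⟨ *-cong (sym (sa-hom i)) (sym (sa-hom j)) ⟩
    ⟦ i ⟧ℤ * ⟦ j ⟧ℤ ∎

  neg-hom : ∀ i → ⟦ ℤ.- i ⟧ℤ ≈ - ⟦ i ⟧ℤ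
  neg-hom (+ zero) = sym -0#≈0#
  neg-hom (+ suc n) = refl
  neg-hom -[1+ n ] = sym (-‿involutive _)

  +-hom : ∀ i j → ⟦ i ℤ.+ j ⟧ℤ ≈ ⟦ i ⟧ℤ + ⟦ j ⟧ℤ
  +-hom -[1+ m ] -[1+ n ] = begin
    - natR (suc (suc (m ℕ.+ n))) ≈⟨ -‿cong (trans (nat-cong (≡.cong suc (≡.sym (ℕₚ.+-suc m n)))) (nat-+ (suc m) (suc n))) ⟩
    - (natR (suc m) + natR (suc n)) ≈⟨ sym (-‿+-comm _ _) ⟩
    - natR (suc m) + - natR (suc n) ∎
  +-hom -[1+ m ] (+ n) = trans (⊖-hom n (suc m)) (+-comm _ _)
  +-hom (+ m) -[1+ n ] = ⊖-hom m (suc n)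
  +-hom (+ m) (+ n) = nat-+ m n

  ZRaw : RawRing _ _
  ZRaw = CommutativeRing.rawRing ℤₚ.+-*-commutativeRing

  ACR : AlmostCommutativeRing c ℓ
  ACR = fromCommutativeRing R

  -- The solver evaluates integer constants with a variant of ⟦_⟧ℤ sending
  -- 0 and 1 literally to 0# and 1#, so that solved equations match goals.
  natR' : ℕ → Carrier
  natR' zero = 0#
  natR' (suc zero) = 1#
  natR' (suc (suc n)) = 1# + natR' (suc n)

  natR'≈ : ∀ n → natR' n ≈ natR n
  natR'≈ zero = refl
  natR'≈ (suc zero) = sym (+-identityʳ _)
  natR'≈ (suc (suc n)) = +-congˡ (natR'≈ (suc n))

  ⟦_⟧' : ℤ → Carrier
  ⟦ + n ⟧' = natR' n
  ⟦ -[1+ n ] ⟧' = - natR' (suc n)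

  ⟦⟧'≈ : ∀ i → ⟦ i ⟧' ≈ ⟦ i ⟧ℤ
  ⟦⟧'≈ (+ n) = natR'≈ n
  ⟦⟧'≈ -[1+ n ] = -‿cong (natR'≈ (suc n))

  morph : ZRaw -Raw-AlmostCommutative⟶ ACR
  morph = record
    { ⟦_⟧ = ⟦_⟧' ; +-homo = λ i j → trans (⟦⟧'≈ (i ℤ.+ j)) (trans (+-hom i j) (sym (+-cong (⟦⟧'≈ i) (⟦⟧'≈ j))))
    ; *-homo = λ i j → trans (⟦⟧'≈ (i ℤ.* j)) (trans (*-hom i j) (sym (*-cong (⟦⟧'≈ i) (⟦⟧'≈ j))))
    ; -‿homo = λ i → trans (⟦⟧'≈ (ℤ.- i)) (trans (neg-hom i) (sym (-‿cong (⟦⟧'≈ i))))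
    ; 0-homo = refl ; 1-homo = refl }

  coeff≟ : WeaklyDecidable (Induced-equivalence morph)
  coeff≟ i j with i ℤ.≟ j
  ... | yes ≡.refl = just refl
  ... | no _ = nothing

  open import Algebra.Solver.Ring ZRaw ACR morph coeff≟ public using (solve; _:=_; _:+_; _:*_; :-_; _:-_; con)


module Theory {c ℓ} (F : CharZeroField c ℓ) where
  open CharZeroField F hiding (zero)
  open WithField F
  open import Relation.Binary.Reasoning.Setoid setoid
  open import Algebra.Properties.Ring ring using (-‿involutive; -‿distribˡ-*; -‿distribʳ-*; -‿+-comm; -0#≈0#)
  open IntegerSolver commRing using (nat-+; nat-*; nat-cong; solve; _:=_; _:+_; _:*_; :-_; _:-_; con)
  open FallingFactorial

  cancelˡ : ∀ {x a b} → ¬ (x ≈ 0#) → x * a ≈ x * b → a ≈ b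
  cancelˡ {x} {a} {b} nz e = begin
    a ≈⟨ sym (*-identityˡ a) ⟩
    1# * a ≈⟨ *-congʳ (sym (trans (*-comm _ _) (inverseʳ x nz))) ⟩
    (x ⁻¹ * x) * a ≈⟨ *-assoc _ _ _ ⟩
    x ⁻¹ * (x * a) ≈⟨ *-congˡ e ⟩
    x ⁻¹ * (x * b) ≈⟨ sym (*-assoc _ _ _) ⟩
    (x ⁻¹ * x) * b ≈⟨ *-congʳ (trans (*-comm _ _) (inverseʳ x nz)) ⟩
    1# * b ≈⟨ *-identityˡ b ⟩
    b ∎

  inv-unique : ∀ {x y} → ¬ (x ≈ 0#) → x * y ≈ 1# → y ≈ x ⁻¹
  inv-unique {x} {y} nz e = cancelˡ nz (trans e (sym (inverseʳ x nz)))

  nat≉0 : ∀ k → .{{ℕ.NonZero k}} → ¬ (nat k ≈ 0#)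
  nat≉0 (suc m) = char0 m

  fact≉0 : ∀ k → ¬ (nat (k !) ≈ 0#)
  fact≉0 k = nat≉0 (k !) {{ℕₚ._!≢0 k}}

  inv-l : ∀ k → invℕ (k !) * nat (k !) ≈ 1#
  inv-l k = trans (*-comm _ _) (inverseʳ _ (fact≉0 k))

  inv-r : ∀ k → nat (k !) * invℕ (k !) ≈ 1#
  inv-r k = inverseʳ _ (fact≉0 k)

  inv1 : invℕ 1 ≈ 1#
  inv1 = sym (inv-unique (char0 0) (trans (*-identityʳ _) (+-identityʳ _)))

  invfact-step : ∀ k → nat (suc k) * invℕ (suc k !) ≈ invℕ (k !)
  invfact-step k = inv-unique (fact≉0 k) (begin
    nat (k !) * (nat (suc k) * invℕ (suc k !)) ≈⟨ sym (*-assoc _ _ _) ⟩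
    (nat (k !) * nat (suc k)) * invℕ (suc k !) ≈⟨ *-congʳ (trans (*-comm _ _) (sym (nat-* (suc k) (k !)))) ⟩
    nat (suc k !) * invℕ (suc k !) ≈⟨ inv-r (suc k) ⟩
    1# ∎)

  Σ : ℕ → (ℕ → Carrier) → Carrier
  Σ = sumBelow

  Σ-cong< : ∀ n {f g : ℕ → Carrier} → (∀ i → i ℕ.< n → f i ≈ g i) → Σ n f ≈ Σ n g
  Σ-cong< zero e = refl
  Σ-cong< (suc n) e = +-cong (Σ-cong< n (λ i i<n → e i (ℕₚ.m<n⇒m<1+n i<n))) (e n ℕₚ.≤-refl)

  Σ-cong : ∀ n {f g : ℕ → Carrier} → (∀ i → f i ≈ g i) → Σ n f ≈ Σ n g
  Σ-cong n e = Σ-cong< n (λ i _ → e i)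

  Σ-+ : ∀ n (f g : ℕ → Carrier) → Σ n (λ i → f i + g i) ≈ Σ n f + Σ n g
  Σ-+ zero f g = sym (+-identityˡ _)
  Σ-+ (suc n) f g = begin
    Σ n (λ i → f i + g i) + (f n + g n) ≈⟨ +-congʳ (Σ-+ n f g) ⟩
    (Σ n f + Σ n g) + (f n + g n) ≈⟨ solve 4 (λ a b c d → (a :+ b) :+ (c :+ d) := (a :+ c) :+ (b :+ d)) refl _ _ _ _ ⟩
    (Σ n f + f n) + (Σ n g + g n) ∎

  Σ-*ˡ : ∀ n (a : Carrier) (f : ℕ → Carrier) → a * Σ n f ≈ Σ n (λ i → a * f i)
  Σ-*ˡ zero a f = zeroʳ _
  Σ-*ˡ (suc n) a f = trans (distribˡ _ _ _) (+-congʳ (Σ-*ˡ n a f))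

  Σ-*ʳ : ∀ n (a : Carrier) (f : ℕ → Carrier) → Σ n f * a ≈ Σ n (λ i → f i * a)
  Σ-*ʳ n a f = trans (*-comm _ _) (trans (Σ-*ˡ n a f) (Σ-cong n (λ i → *-comm _ _)))

  Σ-zero : ∀ n {f : ℕ → Carrier} → (∀ i → i ℕ.< n → f i ≈ 0#) → Σ n f ≈ 0#
  Σ-zero zero e = refl
  Σ-zero (suc n) e = trans (+-cong (Σ-zero n (λ i i<n → e i (ℕₚ.m<n⇒m<1+n i<n))) (e n ℕₚ.≤-refl)) (+-identityˡ _)

  Σ-neg : ∀ n (f : ℕ → Carrier) → Σ n (λ i → - f i) ≈ - Σ n f
  Σ-neg zero f = sym -0#≈0#
  Σ-neg (suc n) f = trans (+-congʳ (Σ-neg n f)) (-‿+-comm _ _)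

  Σ-head : ∀ n (f : ℕ → Carrier) → Σ (suc n) f ≈ f 0 + Σ n (λ i → f (suc i))
  Σ-head zero f = trans (+-identityˡ _) (sym (+-identityʳ _))
  Σ-head (suc n) f = trans (+-congʳ (Σ-head n f)) (+-assoc _ _ _)

  Σ-swap : ∀ m n (f : ℕ → ℕ → Carrier) → Σ m (λ i → Σ n (λ j → f i j)) ≈ Σ n (λ j → Σ m (λ i → f i j))
  Σ-swap zero n f = sym (Σ-zero n (λ _ _ → refl))
  Σ-swap (suc m) n f = trans (+-congʳ (Σ-swap m n f)) (sym (Σ-+ n _ _))

  Σ-ext : ∀ M N {f : ℕ → Carrier} → (∀ i → M ℕ.≤ i → f i ≈ 0#) → M ℕ.≤ N → Σ N f ≈ Σ M f
  Σ-ext M zero e z≤n = refl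
  Σ-ext M (suc N) e M≤ with M ℕ.≟ suc N
  ... | yes ≡.refl = refl
  ... | no M≢ = trans (+-cong (Σ-ext M N e (ℕₚ.≤-pred M<)) (e N (ℕₚ.≤-pred M<))) (+-identityʳ _)
    where M< = ℕₚ.≤∧≢⇒< M≤ M≢

  Σ-ext2 : ∀ M N {f : ℕ → Carrier} → (∀ i → M ℕ.≤ i → f i ≈ 0#) → (∀ i → N ℕ.≤ i → f i ≈ 0#) → Σ M f ≈ Σ N f
  Σ-ext2 M N e1 e2 = trans (sym (Σ-ext M (M ℕ.+ N) e1 (ℕₚ.m≤m+n M N))) (Σ-ext N (M ℕ.+ N) e2 (ℕₚ.m≤n+m N M))

  Σ-rev : ∀ n (f : ℕ → Carrier) → Σ (suc n) f ≈ Σ (suc n) (λ i → f (n ∸ i))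
  Σ-rev zero f = refl
  Σ-rev (suc n) f = begin
    Σ (suc n) f + f (suc n) ≈⟨ +-congʳ (Σ-rev n f) ⟩
    Σ (suc n) (λ i → f (n ∸ i)) + f (suc n) ≈⟨ +-comm _ _ ⟩
    f (suc n) + Σ (suc n) (λ i → f (n ∸ i)) ≈⟨ sym (Σ-head (suc n) (λ i → f (suc n ∸ i))) ⟩
    Σ (suc (suc n)) (λ i → f (suc n ∸ i)) ∎

  Σ-tri : ∀ N (g : ℕ → ℕ → Carrier) →
    Σ N (λ n → Σ (suc n) (λ i → g i (n ∸ i))) ≈ Σ N (λ i → Σ (N ∸ i) (λ j → g i j))
  Σ-tri zero g = refl
  Σ-tri (suc N) g = begin
    Σ N (λ n → Σ (suc n) (λ i → g i (n ∸ i))) + Σ (suc N) (λ i → g i (N ∸ i)) ≈⟨ +-congʳ (Σ-tri N g) ⟩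
    Σ N (λ i → Σ (N ∸ i) (g i)) + (Σ N (λ i → g i (N ∸ i)) + g N (N ∸ N)) ≈⟨ sym (+-assoc _ _ _) ⟩
    (Σ N (λ i → Σ (N ∸ i) (g i)) + Σ N (λ i → g i (N ∸ i))) + g N (N ∸ N) ≈⟨ +-congʳ (sym (Σ-+ N _ _)) ⟩
    Σ N (λ i → Σ (N ∸ i) (g i) + g i (N ∸ i)) + g N (N ∸ N) ≈⟨ +-cong (Σ-cong< N (λ i i<N → reflexive (≡.cong (λ k → Σ k (g i)) (≡.sym (ℕₚ.+-∸-assoc 1 (ℕₚ.<⇒≤ i<N)))))) lastEq ⟩
    Σ N (λ i → Σ (suc N ∸ i) (g i)) + Σ (suc N ∸ N) (g N) ∎
    where
    lastEq : g N (N ∸ N) ≈ Σ (suc N ∸ N) (g N)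
    lastEq = begin
      g N (N ∸ N) ≡⟨ ≡.cong (g N) (ℕₚ.n∸n≡0 N) ⟩
      g N 0 ≈⟨ sym (+-identityˡ _) ⟩
      Σ 1 (g N) ≡⟨ ≡.cong (λ k → Σ k (g N)) (≡.sym (≡.trans (ℕₚ.+-∸-assoc 1 (ℕₚ.≤-refl {N})) (≡.cong suc (ℕₚ.n∸n≡0 N)))) ⟩
      Σ (suc N ∸ N) (g N) ∎

  -- Formal power series (Series = ℕ → Carrier, product _⋆_ from Defs) form a
  -- commutative ring SR under coefficientwise equality _≋_.

  infix 4 _≋_
  record _≋_ (f g : Series) : Set ℓ where
    constructor mk≋
    field app : ∀ n → f n ≈ g n
  open _≋_ public

  ≋-refl : ∀ {f} → f ≋ f
  ≋-refl = mk≋ λ n → refl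

  ≋-sym : ∀ {f g} → f ≋ g → g ≋ f
  ≋-sym e = mk≋ λ n → sym (app e n)

  ≋-trans : ∀ {f g h} → f ≋ g → g ≋ h → f ≋ h
  ≋-trans e e' = mk≋ λ n → trans (app e n) (app e' n)

  reflexive≋ : ∀ {f g} → f ≡ g → f ≋ g
  reflexive≋ ≡.refl = ≋-refl

  infix  1 begin≋_
  infixr 2 _≋⟨_⟩_
  infix  3 _∎≋
  begin≋_ : ∀ {f g} → f ≋ g → f ≋ g
  begin≋ e = e
  _≋⟨_⟩_ : ∀ f {g h} → f ≋ g → g ≋ h → f ≋ h
  f ≋⟨ e ⟩ e' = ≋-trans e e'
  _∎≋ : ∀ f → f ≋ f
  f ∎≋ = ≋-refl

  infixl 6 _⊕_
  _⊕_ : Series → Series → Series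
  (f ⊕ g) n = f n + g n

  ⊝_ : Series → Series
  (⊝ f) n = - f n

  zeroS : Series
  zeroS _ = 0#

  ⊕-cong : ∀ {f f' g g'} → f ≋ f' → g ≋ g' → f ⊕ g ≋ f' ⊕ g'
  ⊕-cong ef eg = mk≋ λ n → +-cong (app ef n) (app eg n)

  ⋆-cong : ∀ {f f' g g'} → f ≋ f' → g ≋ g' → f ⋆ g ≋ f' ⋆ g'
  ⋆-cong ef eg = mk≋ λ n → Σ-cong (suc n) (λ i → *-cong (app ef i) (app eg (n ∸ i)))

  ⋆-comm : ∀ f g → f ⋆ g ≋ g ⋆ f
  ⋆-comm f g = mk≋ λ n → begin
    Σ (suc n) (λ i → f i * g (n ∸ i)) ≈⟨ Σ-rev n _ ⟩
    Σ (suc n) (λ i → f (n ∸ i) * g (n ∸ (n ∸ i))) ≈⟨ Σ-cong< (suc n) (λ i i<n → trans (*-comm _ _) (*-congʳ (reflexive (≡.cong g (ℕₚ.m∸[m∸n]≡n (ℕₚ.≤-pred i<n)))))) ⟩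
    Σ (suc n) (λ i → g i * f (n ∸ i)) ∎

  ⋆-distribˡ : ∀ f g h → f ⋆ (g ⊕ h) ≋ f ⋆ g ⊕ f ⋆ h
  ⋆-distribˡ f g h = mk≋ λ n → trans (Σ-cong (suc n) (λ i → distribˡ _ _ _)) (Σ-+ (suc n) _ _)

  ⋆-identityˡ : ∀ f → oneS ⋆ f ≋ f
  ⋆-identityˡ f = mk≋ λ n → begin
    Σ (suc n) (λ i → oneS i * f (n ∸ i)) ≈⟨ Σ-head n _ ⟩
    1# * f n + Σ n (λ i → 0# * f (n ∸ suc i)) ≈⟨ +-cong (*-identityˡ _) (Σ-zero n (λ i _ → zeroˡ _)) ⟩
    f n + 0# ≈⟨ +-identityʳ _ ⟩
    f n ∎

  -- both sides are Σ f a g b h c over a + b + c = n (Σ-tri does the reindexing)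
  ⋆-assoc : ∀ f g h → (f ⋆ g) ⋆ h ≋ f ⋆ (g ⋆ h)
  ⋆-assoc f g h = mk≋ λ n → begin
    Σ (suc n) (λ i → Σ (suc i) (λ a → f a * g (i ∸ a)) * h (n ∸ i))
      ≈⟨ Σ-cong (suc n) (λ i → Σ-*ʳ (suc i) _ _) ⟩
    Σ (suc n) (λ i → Σ (suc i) (λ a → f a * g (i ∸ a) * h (n ∸ i)))
      ≈⟨ Σ-cong (suc n) (λ i → Σ-cong< (suc i) (λ a a<i → *-congˡ (reflexive (≡.cong (λ k → h (n ∸ k)) (≡.sym (ℕₚ.m+[n∸m]≡n (ℕₚ.≤-pred a<i))))))) ⟩
    Σ (suc n) (λ i → Σ (suc i) (λ a → G n a (i ∸ a)))
      ≈⟨ Σ-tri (suc n) (G n) ⟩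
    Σ (suc n) (λ a → Σ (suc n ∸ a) (λ j → G n a j))
      ≈⟨ Σ-cong< (suc n) (λ a a<n → trans (reflexive (≡.cong (λ k → Σ k (G n a)) (ℕₚ.+-∸-assoc 1 (ℕₚ.≤-pred a<n))))
           (trans (Σ-cong (suc (n ∸ a)) (λ j → trans (*-assoc _ _ _) (*-congˡ (*-congˡ (reflexive (≡.cong h (≡.sym (ℕₚ.∸-+-assoc n a j)))))))) (sym (Σ-*ˡ (suc (n ∸ a)) _ _)))) ⟩
    Σ (suc n) (λ a → f a * Σ (suc (n ∸ a)) (λ b → g b * h (n ∸ a ∸ b))) ∎
    where
    G : ℕ → ℕ → ℕ → Carrier
    G n a j = f a * g j * h (n ∸ (a ℕ.+ j))

  SR : CommutativeRing c ℓ
  SR = record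
    { Carrier = Series ; _≈_ = _≋_ ; _+_ = _⊕_ ; _*_ = _⋆_ ; -_ = ⊝_ ; 0# = zeroS ; 1# = oneS
    ; isCommutativeRing = record
      { isRing = record
        { +-isAbelianGroup = record
          { isGroup = record
            { isMonoid = record
              { isSemigroup = record
                { isMagma = record
                  { isEquivalence = record { refl = ≋-refl ; sym = ≋-sym ; trans = ≋-trans }
                  ; ∙-cong = ⊕-cong }
                ; assoc = λ f g h → mk≋ λ n → +-assoc _ _ _ }
              ; identity = (λ f → mk≋ λ n → +-identityˡ _) , (λ f → mk≋ λ n → +-identityʳ _) }
            ; inverse = (λ f → mk≋ λ n → -‿inverseˡ _) , (λ f → mk≋ λ n → -‿inverseʳ _)
            ; ⁻¹-cong = λ e → mk≋ λ n → -‿cong (app e n) }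
          ; comm = λ f g → mk≋ λ n → +-comm _ _ }
        ; *-cong = ⋆-cong
        ; *-assoc = ⋆-assoc
        ; *-identity = ⋆-identityˡ , (λ f → ≋-trans (⋆-comm f oneS) (⋆-identityˡ f))
        ; distrib = ⋆-distribˡ , (λ f g h → ≋-trans (⋆-comm (g ⊕ h) f) (≋-trans (⋆-distribˡ f g h) (⊕-cong (⋆-comm f g) (⋆-comm f h)))) }
      ; *-comm = ⋆-comm } }

  module SRR = CommutativeRing SR
  open IntegerSolver SR using () renaming (solve to solveS; _:+_ to infixl 7 _⊞_; _:*_ to infixl 8 _⊠_; con to conS; _:=_ to infix 4 _≔_; :-_ to infix 9 ⊟_; _:-_ to infixl 7 _⊟_)

  ⋆-congˡ : ∀ {f f'} g → f ≋ f' → f ⋆ g ≋ f' ⋆ g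
  ⋆-congˡ g e = ⋆-cong e (≋-refl {g})

  ⋆-congʳ : ∀ f {g g'} → g ≋ g' → f ⋆ g ≋ f ⋆ g'
  ⋆-congʳ f e = ⋆-cong (≋-refl {f}) e

  ⊕-congˡ : ∀ {f f'} g → f ≋ f' → f ⊕ g ≋ f' ⊕ g
  ⊕-congˡ g e = ⊕-cong e (≋-refl {g})

  ⊕-congʳ : ∀ f {g g'} → g ≋ g' → f ⊕ g ≋ f ⊕ g'
  ⊕-congʳ f e = ⊕-cong (≋-refl {f}) e

  constS : Carrier → Series
  constS a zero = a
  constS a (suc _) = 0#

  infixr 7 _·ₛ_
  _·ₛ_ : Carrier → Series → Series
  (a ·ₛ f) n = a * f n

  const-⋆ : ∀ a f → constS a ⋆ f ≋ a ·ₛ f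
  const-⋆ a f = mk≋ λ n → begin
    Σ (suc n) (λ i → constS a i * f (n ∸ i)) ≈⟨ Σ-head n _ ⟩
    a * f n + Σ n (λ i → 0# * f (n ∸ suc i)) ≈⟨ +-congˡ (Σ-zero n (λ i _ → zeroˡ _)) ⟩
    a * f n + 0# ≈⟨ +-identityʳ _ ⟩
    a * f n ∎

  natS : ∀ k → natIn SR k ≋ constS (nat k)
  natS k = mk≋ (coefficients k)
    where
    coefficients : ∀ k n → natIn SR k n ≈ constS (nat k) n
    coefficients zero zero = refl
    coefficients zero (suc n) = refl
    coefficients (suc k) zero = +-congˡ (coefficients k zero)
    coefficients (suc k) (suc n) = trans (+-congˡ (coefficients k (suc n))) (+-identityʳ _)

  ·-cong : ∀ {a b f g} → a ≈ b → f ≋ g → a ·ₛ f ≋ b ·ₛ g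
  ·-cong e e' = mk≋ λ n → *-cong e (app e' n)

  ·-⋆ˡ : ∀ a f g → (a ·ₛ f) ⋆ g ≋ a ·ₛ (f ⋆ g)
  ·-⋆ˡ a f g = mk≋ λ n → trans (Σ-cong (suc n) (λ i → *-assoc _ _ _)) (sym (Σ-*ˡ (suc n) a _))

  ·-⋆ʳ : ∀ a f g → f ⋆ (a ·ₛ g) ≋ a ·ₛ (f ⋆ g)
  ·-⋆ʳ a f g = ≋-trans (⋆-comm f _) (≋-trans (·-⋆ˡ a g f) (·-cong refl (⋆-comm g f)))

  ·-⊕ : ∀ a f g → a ·ₛ (f ⊕ g) ≋ a ·ₛ f ⊕ a ·ₛ g
  ·-⊕ a f g = mk≋ λ n → distribˡ _ _ _

  ·-· : ∀ a b f → a ·ₛ (b ·ₛ f) ≋ (a * b) ·ₛ f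
  ·-· a b f = mk≋ λ n → sym (*-assoc _ _ _)

  powS0 : ∀ f → powS f 0 ≋ oneS
  powS0 f = mk≋ λ { zero → refl ; (suc n) → refl }

  powS-cong : ∀ {f g} j → f ≋ g → powS f j ≋ powS g j
  powS-cong zero e = ≋-trans (powS0 _) (≋-sym (powS0 _))
  powS-cong (suc j) e = ⋆-cong e (powS-cong j e)

  powS-+ : ∀ f a b → powS f (a ℕ.+ b) ≋ powS f a ⋆ powS f b
  powS-+ f zero b = ≋-sym (≋-trans (⋆-congˡ (powS f b) (powS0 f)) (⋆-identityˡ (powS f b)))
  powS-+ f (suc a) b = ≋-trans (⋆-congʳ f (powS-+ f a b)) (≋-sym (⋆-assoc f (powS f a) (powS f b)))

  powS-ord : ∀ f → f 0 ≈ 0# → ∀ j n → n ℕ.< j → powS f j n ≈ 0#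
  powS-ord f f0 (suc j) n n<j = begin
    Σ (suc n) (λ i → f i * powS f j (n ∸ i)) ≈⟨ Σ-head n _ ⟩
    f 0 * powS f j n + Σ n (λ i → f (suc i) * powS f j (n ∸ suc i)) ≈⟨ +-cong (trans (*-congʳ f0) (zeroˡ _)) (Σ-zero n (λ i i<n → trans (*-congˡ (powS-ord f f0 j (n ∸ suc i) (degree-drop i i<n))) (zeroʳ _))) ⟩
    0# + 0# ≈⟨ +-identityʳ _ ⟩
    0# ∎
    where
    degree-drop : ∀ i → i ℕ.< n → n ∸ suc i ℕ.< j
    degree-drop i i<n = ℕₚ.<-≤-trans (ℕₚ.∸-monoʳ-< {n} {suc i} {0} (s≤s z≤n) i<n) (ℕₚ.≤-pred n<j)

  dS : Series → Series
  dS f n = nat (suc n) * f (suc n)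

  dS-cong : ∀ {f g} → f ≋ g → dS f ≋ dS g
  dS-cong e = mk≋ λ n → *-congˡ (app e (suc n))

  dS-⊕ : ∀ f g → dS (f ⊕ g) ≋ dS f ⊕ dS g
  dS-⊕ f g = mk≋ λ n → distribˡ _ _ _

  dS-· : ∀ a f → dS (a ·ₛ f) ≋ a ·ₛ dS f
  dS-· a f = mk≋ λ n → solve 3 (λ k a x → k :* (a :* x) := a :* (k :* x)) refl _ _ _

  dS-⊝ : ∀ f → dS (⊝ f) ≋ ⊝ dS f
  dS-⊝ f = mk≋ λ n → sym (-‿distribʳ-* _ _)

  dS-one : dS oneS ≋ zeroS
  dS-one = mk≋ λ n → zeroʳ _

  dS-zero : ∀ {f} → f ≋ zeroS → dS f ≋ zeroS
  dS-zero e = mk≋ λ n → trans (*-congˡ (app e (suc n))) (zeroʳ _)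

  -- Leibniz rule: split the weight n+1 = i + (n+1-i) in each term of the product
  leibniz : ∀ f g → dS (f ⋆ g) ≋ dS f ⋆ g ⊕ f ⋆ dS g
  leibniz f g = mk≋ λ n → begin
    nat (suc n) * Σ (suc (suc n)) (λ i → f i * g (suc n ∸ i)) ≈⟨ Σ-*ˡ (suc (suc n)) _ _ ⟩
    Σ (suc (suc n)) (λ i → nat (suc n) * (f i * g (suc n ∸ i))) ≈⟨ Σ-cong< (suc (suc n)) (λ i i<n → trans (*-congʳ (trans (nat-cong (≡.sym (ℕₚ.m+[n∸m]≡n (ℕₚ.≤-pred i<n)))) (nat-+ i (suc n ∸ i)))) (distribʳ _ _ _)) ⟩
    Σ (suc (suc n)) (λ i → nat i * (f i * g (suc n ∸ i)) + nat (suc n ∸ i) * (f i * g (suc n ∸ i))) ≈⟨ Σ-+ (suc (suc n)) _ _ ⟩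
    Σ (suc (suc n)) (λ i → nat i * (f i * g (suc n ∸ i))) + Σ (suc (suc n)) (λ i → nat (suc n ∸ i) * (f i * g (suc n ∸ i))) ≈⟨ +-cong (left n) (right n) ⟩
    Σ (suc n) (λ i → dS f i * g (n ∸ i)) + Σ (suc n) (λ i → f i * dS g (n ∸ i)) ∎
    where
    left : ∀ n → Σ (suc (suc n)) (λ i → nat i * (f i * g (suc n ∸ i))) ≈ Σ (suc n) (λ i → dS f i * g (n ∸ i))
    left n = begin
      Σ (suc (suc n)) (λ i → nat i * (f i * g (suc n ∸ i))) ≈⟨ Σ-head (suc n) _ ⟩
      0# * (f 0 * g (suc n)) + Σ (suc n) (λ i → nat (suc i) * (f (suc i) * g (n ∸ i))) ≈⟨ +-cong (zeroˡ _) (Σ-cong (suc n) (λ i → sym (*-assoc _ _ _))) ⟩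
      0# + Σ (suc n) (λ i → dS f i * g (n ∸ i)) ≈⟨ +-identityˡ _ ⟩
      Σ (suc n) (λ i → dS f i * g (n ∸ i)) ∎
    right : ∀ n → Σ (suc (suc n)) (λ i → nat (suc n ∸ i) * (f i * g (suc n ∸ i))) ≈ Σ (suc n) (λ i → f i * dS g (n ∸ i))
    right n = begin
      Σ (suc n) (λ i → nat (suc n ∸ i) * (f i * g (suc n ∸ i))) + nat (suc n ∸ suc n) * (f (suc n) * g (suc n ∸ suc n)) ≈⟨ +-cong (Σ-cong< (suc n) (λ i i<n → trans (reflexive (≡.cong (λ k → nat k * (f i * g k)) (ℕₚ.+-∸-assoc 1 (ℕₚ.≤-pred i<n)))) (solve 3 (λ k a b → k :* (a :* b) := a :* (k :* b)) refl _ _ _))) (trans (*-congʳ (nat-cong (ℕₚ.n∸n≡0 n))) (zeroˡ _)) ⟩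
      Σ (suc n) (λ i → f i * dS g (n ∸ i)) + 0# ≈⟨ +-identityʳ _ ⟩
      Σ (suc n) (λ i → f i * dS g (n ∸ i)) ∎

  natC : ℕ → Series
  natC k = natIn SR k

  nat-·ₛ : ∀ k f → nat k ·ₛ f ≋ natC k ⋆ f
  nat-·ₛ k f = ≋-sym (≋-trans (⋆-congˡ f (natS k)) (const-⋆ (nat k) f))

  dS-powS : ∀ f j → dS (powS f (suc j)) ≋ natC (suc j) ⋆ (powS f j ⋆ dS f)
  dS-powS f zero = begin≋
      dS (f ⋆ p0) ≋⟨ leibniz f p0 ⟩
      dS f ⋆ p0 ⊕ f ⋆ dS p0 ≋⟨ ⊕-congʳ (dS f ⋆ p0) (⋆-congʳ f (≋-trans (dS-cong (powS0 f)) dS-one)) ⟩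
      dS f ⋆ p0 ⊕ f ⋆ zeroS ≋⟨ solveS 3 (λ a b k → a ⊠ b ⊞ k ⊠ conS (+ 0) ≔ conS (+ 1) ⊠ (b ⊠ a)) SRR.refl (dS f) p0 f ⟩
      oneS ⋆ (p0 ⋆ dS f) ≋⟨ ⋆-congˡ (p0 ⋆ dS f) (mk≋ λ n → sym (+-identityʳ _)) ⟩
      natC 1 ⋆ (p0 ⋆ dS f) ∎≋
    where
    p0 = powS f 0
  dS-powS f (suc j) = begin≋
      dS (f ⋆ pj1) ≋⟨ leibniz f pj1 ⟩
      dS f ⋆ pj1 ⊕ f ⋆ dS pj1 ≋⟨ ⊕-congʳ (dS f ⋆ pj1) (⋆-congʳ f (dS-powS f j)) ⟩
      dS f ⋆ (f ⋆ pj) ⊕ f ⋆ (k ⋆ (pj ⋆ dS f)) ≋⟨ solveS 4 (λ a b c kk → a ⊠ (b ⊠ c) ⊞ b ⊠ (kk ⊠ (c ⊠ a)) ≔ (conS (+ 1) ⊞ kk) ⊠ ((b ⊠ c) ⊠ a)) SRR.refl (dS f) f pj k ⟩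
      natC (suc (suc j)) ⋆ (pj1 ⋆ dS f) ∎≋
    where
    pj = powS f j
    pj1 = powS f (suc j)
    k = natC (suc j)

  -- Uniqueness for the linear ODE Q' = M Q: the equation determines the
  -- coefficient of degree n+1 from those of degree ≤ n, since n+1 ≠ 0 in F.
  -- This is how every identity between P_a, eᵗ, T below is proved.
  ode-unique : ∀ M Q R → dS Q ≋ M ⋆ Q → dS R ≋ M ⋆ R → Q 0 ≈ R 0 → Q ≋ R
  ode-unique M Q R eQ eR e0 = mk≋ λ n → go n n ℕₚ.≤-refl
    where
    go : ∀ n m → m ℕ.≤ n → Q m ≈ R m
    go zero zero z≤n = e0
    go (suc n) m m≤ with m ℕ.≟ suc n
    ... | no m≢ = go n m (ℕₚ.≤-pred (ℕₚ.≤∧≢⇒< m≤ m≢))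
    ... | yes ≡.refl = cancelˡ (char0 n) (begin
        nat (suc n) * Q (suc n) ≈⟨ app eQ n ⟩
        Σ (suc n) (λ i → M i * Q (n ∸ i)) ≈⟨ Σ-cong (suc n) (λ i → *-congˡ (go n (n ∸ i) (ℕₚ.m∸n≤m n i))) ⟩
        Σ (suc n) (λ i → M i * R (n ∸ i)) ≈⟨ sym (app eR n) ⟩
        nat (suc n) * R (suc n) ∎)

  const-cong : ∀ {a b} → a ≈ b → constS a ≋ constS b
  const-cong e = mk≋ λ { zero → e ; (suc n) → refl }

  const-+ : ∀ a b → constS (a + b) ≋ constS a ⊕ constS b
  const-+ a b = mk≋ λ { zero → refl ; (suc n) → sym (+-identityʳ _) }

  const-* : ∀ a b → constS (a * b) ≋ constS a ⋆ constS b
  const-* a b = ≋-sym (≋-trans (const-⋆ a (constS b)) (mk≋ λ { zero → refl ; (suc n) → zeroʳ _ }))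

  const-neg : ∀ a → constS (- a) ≋ ⊝ constS a
  const-neg a = mk≋ λ { zero → refl ; (suc n) → sym -0#≈0# }

  const-1 : constS 1# ≋ oneS
  const-1 = mk≋ λ { zero → refl ; (suc n) → refl }

  const-0 : constS 0# ≋ zeroS
  const-0 = mk≋ λ { zero → refl ; (suc n) → refl }

  dS-const : ∀ a f → dS (constS a ⋆ f) ≋ constS a ⋆ dS f
  dS-const a f = ≋-trans (dS-cong (const-⋆ a f)) (≋-trans (dS-· a f) (≋-sym (const-⋆ a (dS f))))

  ⋆-trunc : ∀ {f g} h n → (∀ i → i ℕ.≤ n → f i ≈ g i) → (f ⋆ h) n ≈ (g ⋆ h) n
  ⋆-trunc h n e = Σ-cong< (suc n) (λ i i<n → *-congʳ (e i (ℕₚ.≤-pred i<n)))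

  ⋆-truncʳ : ∀ {f g} h n → (∀ i → i ℕ.≤ n → f i ≈ g i) → (h ⋆ f) n ≈ (h ⋆ g) n
  ⋆-truncʳ {f} {g} h n e = trans (app (⋆-comm h f) n) (trans (⋆-trunc h n e) (app (⋆-comm g h) n))

  ⋆-ord : ∀ f h n → (∀ i → i ℕ.≤ n → f i ≈ 0#) → (f ⋆ h) n ≈ 0#
  ⋆-ord f h n e = Σ-zero (suc n) (λ i i<n → trans (*-congʳ (e i (ℕₚ.≤-pred i<n))) (zeroˡ _))

  ΣS : ℕ → (ℕ → Series) → Series
  ΣS N F n = Σ N (λ j → F j n)

  ΣS-cong : ∀ N {F G} → (∀ j → F j ≋ G j) → ΣS N F ≋ ΣS N G
  ΣS-cong N e = mk≋ λ n → Σ-cong N (λ j → app (e j) n)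

  ΣS-⋆ : ∀ N F h → ΣS N F ⋆ h ≋ ΣS N (λ j → F j ⋆ h)
  ΣS-⋆ zero F h = mk≋ λ n → Σ-zero (suc n) (λ i _ → zeroˡ _)
  ΣS-⋆ (suc N) F h = ≋-trans (≋-trans (⋆-comm (ΣS N F ⊕ F N) h) (⋆-distribˡ h (ΣS N F) (F N)))
     (⊕-cong (≋-trans (⋆-comm h (ΣS N F)) (ΣS-⋆ N F h)) (⋆-comm h (F N)))

  -- a series Σⱼ cⱼ gʲ with g(0) = 0 has the same coefficient of degree n as
  -- any of its truncations Σ_{j<N} cⱼ gʲ with N > n; this makes the
  -- definitions recipS and powerC of Defs behave like infinite sums
  trunc-pow : ∀ (cf : ℕ → Carrier) g → g 0 ≈ 0# → ∀ n N → n ℕ.< N →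
    Σ (suc n) (λ j → cf j * powS g j n) ≈ Σ N (λ j → cf j * powS g j n)
  trunc-pow cf g g0 n N n<N = Σ-ext2 (suc n) N
    (λ j n<j → trans (*-congˡ (powS-ord g g0 j n n<j)) (zeroʳ _))
    (λ j N≤j → trans (*-congˡ (powS-ord g g0 j n (ℕₚ.<-≤-trans n<N N≤j))) (zeroʳ _))

  -- The series E = (eᵗ - 1)/t and T = t/(eᵗ - 1) of Defs are inverse:
  -- T = Σⱼ wʲ with w = 1 - E, a geometric series.

  E : Series
  E = expm1OverT

  E0 : E 0 ≈ 1#
  E0 = inv1

  w : Series
  w m = oneS m - E m

  w0 : w 0 ≈ 0#
  w0 = trans (+-congˡ (-‿cong E0)) (-‿inverseʳ _)

  E-w : oneS ⊕ ⊝ w ≋ E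
  E-w = mk≋ λ n → solve 2 (λ o e → o :+ (:- (o :- e)) := e) refl (oneS n) (E n)

  T : Series
  T = todd

  geom : ∀ N → ΣS N (powS w) ⋆ (oneS ⊕ ⊝ w) ≋ oneS ⊕ ⊝ powS w N
  geom zero = ≋-trans (mk≋ λ n → Σ-zero (suc n) (λ i _ → zeroˡ _)) (mk≋ λ { zero → sym (-‿inverseʳ _) ; (suc n) → sym (trans (+-identityˡ _) -0#≈0#) })
  geom (suc N) = begin≋
    (ΣS N (powS w) ⊕ powS w N) ⋆ (oneS ⊕ ⊝ w) ≋⟨ SRR.distribʳ (oneS ⊕ ⊝ w) (ΣS N (powS w)) (powS w N) ⟩
    ΣS N (powS w) ⋆ (oneS ⊕ ⊝ w) ⊕ powS w N ⋆ (oneS ⊕ ⊝ w) ≋⟨ ⊕-congˡ (powS w N ⋆ (oneS ⊕ ⊝ w)) (geom N) ⟩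
    (oneS ⊕ ⊝ powS w N) ⊕ powS w N ⋆ (oneS ⊕ ⊝ w) ≋⟨ solveS 2 (λ p x → (conS (+ 1) ⊞ ⊟ p) ⊞ p ⊠ (conS (+ 1) ⊞ ⊟ x) ≔ conS (+ 1) ⊞ ⊟ (x ⊠ p)) SRR.refl (powS w N) w ⟩
    oneS ⊕ ⊝ powS w (suc N) ∎≋

  T-trunc : ∀ n N → n ℕ.< N → T n ≈ ΣS N (powS w) n
  T-trunc n N n<N = trans (Σ-cong (suc n) (λ j → sym (*-identityˡ _))) (trans (trunc-pow (λ _ → 1#) w w0 n N n<N) (Σ-cong N (λ j → *-identityˡ _)))

  -- T E = 1, comparing coefficients with a long enough geometric sum
  T⋆E : T ⋆ E ≋ oneS
  T⋆E = mk≋ λ n → begin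
    (T ⋆ E) n ≈⟨ ⋆-trunc E n (λ i i≤n → T-trunc i (suc n) (s≤s i≤n)) ⟩
    (ΣS (suc n) (powS w) ⋆ E) n ≈⟨ sym (app (⋆-congʳ (ΣS (suc n) (powS w)) E-w) n) ⟩
    (ΣS (suc n) (powS w) ⋆ (oneS ⊕ ⊝ w)) n ≈⟨ app (geom (suc n)) n ⟩
    oneS n - powS w (suc n) n ≈⟨ +-congˡ (trans (-‿cong (powS-ord w w0 (suc n) n ℕₚ.≤-refl)) -0#≈0#) ⟩
    oneS n + 0# ≈⟨ +-identityʳ _ ⟩
    oneS n ∎

  E⋆T : E ⋆ T ≋ oneS
  E⋆T = ≋-trans (⋆-comm E T) T⋆E

  -- P_a = T^a is, by definition, the binomial series Σⱼ binom(a, j) uʲ in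
  -- u = T - 1.

  u : Series
  u m = T m - oneS m

  u0 : u 0 ≈ 0#
  u0 = trans (+-congʳ (+-identityˡ _)) (-‿inverseʳ 1#)

  T-u : oneS ⊕ u ≋ T
  T-u = mk≋ λ n → solve 2 (λ o t → o :+ (t :- o) := t) refl (oneS n) (T n)

  du-dT : dS u ≋ dS T
  du-dT = mk≋ λ n → *-congˡ (trans (+-congˡ -0#≈0#) (+-identityʳ _))

  binom0 : ∀ a → binomC a 0 ≈ 1#
  binom0 a = trans (*-identityˡ _) inv1

  binom1 : ∀ a → binomC a 1 ≈ a
  binom1 a = trans (*-congʳ (*-identityˡ _)) (trans (*-cong (trans (+-congˡ -0#≈0#) (+-identityʳ a)) inv1) (*-identityʳ a))

  binom-rec : ∀ a j → nat (suc j) * binomC a (suc j) ≈ (a - nat j) * binomC a j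
  binom-rec a j = begin
    nat (suc j) * ((fallingFact a j * (a - nat j)) * invℕ (suc j !)) ≈⟨ solve 4 (λ k f x i → k :* ((f :* x) :* i) := x :* (f :* (k :* i))) refl _ _ _ _ ⟩
    (a - nat j) * (fallingFact a j * (nat (suc j) * invℕ (suc j !))) ≈⟨ *-congˡ (*-congˡ (invfact-step j)) ⟩
    (a - nat j) * (fallingFact a j * invℕ (j !)) ∎

  -- The partial sums S_N = Σ_{j<N} binom(a,j) uʲ satisfy
  --   (1 + u) S_N' = a u' S_N - N binom(a,N) u^{N-1} u',
  -- and the error term has no coefficients below degree N - 1.  Comparing
  -- coefficients with N large gives T P_a' = a T' P_a.
  module _ (a : Carrier) where
    bTerm : ℕ → Series
    bTerm j = constS (binomC a j)

    partialP : ℕ → Series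
    partialP N = ΣS N (λ j → bTerm j ⋆ powS u j)

    partialP-err : ℕ → Series
    partialP-err N = constS (nat N * binomC a N) ⋆ (powS u (N ∸ 1) ⋆ dS u)

    aS : Series
    aS = constS a

    -- adding the term of degree N: (N+1) binom(a,N+1) = (a - N) binom(a,N)
    -- turns the error term for N into the one for N+1
    partialP-step : ∀ N → (aS ⋆ (dS u ⋆ partialP N) ⊕ ⊝ partialP-err N) ⊕ (oneS ⊕ u) ⋆ (bTerm N ⋆ dS (powS u N))
                 ≋ aS ⋆ (dS u ⋆ (partialP N ⊕ bTerm N ⋆ powS u N)) ⊕ ⊝ partialP-err (suc N)
    partialP-step zero = begin≋
      (aS ⋆ (dS u ⋆ partialP 0) ⊕ ⊝ partialP-err 0) ⊕ (oneS ⊕ u) ⋆ (bTerm 0 ⋆ dS (powS u 0))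
        ≋⟨ SRR.+-cong (SRR.+-congˡ (SRR.-‿cong err0)) (⋆-congʳ (oneS ⊕ u) (⋆-cong C0 (≋-trans (dS-cong (powS0 u)) dS-one))) ⟩
      (aS ⋆ (dS u ⋆ partialP 0) ⊕ ⊝ zeroS) ⊕ (oneS ⊕ u) ⋆ (oneS ⋆ zeroS)
        ≋⟨ solveS 4 (λ a d s x → (a ⊠ (d ⊠ s) ⊞ ⊟ conS (+ 0)) ⊞ (conS (+ 1) ⊞ x) ⊠ (conS (+ 1) ⊠ conS (+ 0))
                              ≔ a ⊠ (d ⊠ (s ⊞ conS (+ 1) ⊠ conS (+ 1))) ⊞ ⊟ (a ⊠ (conS (+ 1) ⊠ d))) SRR.refl aS (dS u) (partialP 0) u ⟩
      aS ⋆ (dS u ⋆ (partialP 0 ⊕ oneS ⋆ oneS)) ⊕ ⊝ (aS ⋆ (oneS ⋆ dS u))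
        ≋⟨ SRR.+-cong (⋆-congʳ aS (⋆-congʳ (dS u) (⊕-congʳ (partialP 0) (≋-sym (⋆-cong C0 (powS0 u))))))
                      (SRR.-‿cong (≋-sym (⋆-cong (const-cong {nat 1 * binomC a 1} (trans (*-congʳ (+-identityʳ 1#)) (trans (*-identityˡ _) (binom1 a)))) (⋆-congˡ (dS u) (powS0 u))))) ⟩
      aS ⋆ (dS u ⋆ (partialP 0 ⊕ bTerm 0 ⋆ powS u 0)) ⊕ ⊝ partialP-err 1 ∎≋
      where
      err0 : partialP-err 0 ≋ zeroS
      err0 = ≋-trans (⋆-congˡ (powS u 0 ⋆ dS u) (≋-trans (const-cong (zeroˡ (binomC a 0))) const-0)) (SRR.zeroˡ (powS u 0 ⋆ dS u))
      C0 : bTerm 0 ≋ oneS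
      C0 = ≋-trans (const-cong (binom0 a)) const-1
    partialP-step (suc M) = begin≋
      (aS ⋆ (dS u ⋆ partialP (suc M)) ⊕ ⊝ partialP-err (suc M)) ⊕ (oneS ⊕ u) ⋆ (bTerm (suc M) ⋆ dS (powS u (suc M)))
        ≋⟨ SRR.+-cong (SRR.+-congˡ (SRR.-‿cong (⋆-congˡ (powS u M ⋆ dS u) c1k))) (⋆-congʳ (oneS ⊕ u) (⋆-congʳ (bTerm (suc M)) (dS-powS u M))) ⟩
      (aS ⋆ (dS u ⋆ partialP (suc M)) ⊕ ⊝ ((k ⋆ bTerm (suc M)) ⋆ (powS u M ⋆ dS u))) ⊕ (oneS ⊕ u) ⋆ (bTerm (suc M) ⋆ (k ⋆ (powS u M ⋆ dS u)))
        ≋⟨ solveS 7 (λ a d s k c1 um uu → (a ⊠ (d ⊠ s) ⊞ ⊟ ((k ⊠ c1) ⊠ (um ⊠ d))) ⊞ (conS (+ 1) ⊞ uu) ⊠ (c1 ⊠ (k ⊠ (um ⊠ d)))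
                  ≔ a ⊠ (d ⊠ (s ⊞ c1 ⊠ (uu ⊠ um))) ⊞ ⊟ (((a ⊞ ⊟ k) ⊠ c1) ⊠ ((uu ⊠ um) ⊠ d)))
                  SRR.refl aS (dS u) (partialP (suc M)) k (bTerm (suc M)) (powS u M) u ⟩
      aS ⋆ (dS u ⋆ (partialP (suc M) ⊕ bTerm (suc M) ⋆ powS u (suc M))) ⊕ ⊝ (((aS ⊕ ⊝ k) ⋆ bTerm (suc M)) ⋆ (powS u (suc M) ⋆ dS u))
        ≋⟨ SRR.+-congˡ (SRR.-‿cong (⋆-congˡ (powS u (suc M) ⋆ dS u) c2)) ⟩
      aS ⋆ (dS u ⋆ (partialP (suc M) ⊕ bTerm (suc M) ⋆ powS u (suc M))) ⊕ ⊝ partialP-err (suc (suc M)) ∎≋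
      where
      k = natC (suc M)
      c1k : constS (nat (suc M) * binomC a (suc M)) ≋ k ⋆ bTerm (suc M)
      c1k = ≋-trans (const-* _ _) (⋆-congˡ (bTerm (suc M)) (≋-sym (natS (suc M))))
      c2 : (aS ⊕ ⊝ k) ⋆ bTerm (suc M) ≋ constS (nat (suc (suc M)) * binomC a (suc (suc M)))
      c2 = ≋-sym (≋-trans (const-cong (binom-rec a (suc M))) (≋-trans (const-* _ _)
             (⋆-congˡ (bTerm (suc M)) (≋-trans (const-+ a (- nat (suc M))) (⊕-congʳ aS (≋-trans (const-neg _) (SRR.-‿cong (≋-sym (natS (suc M))))))))))

    partialP-ode : ∀ N → (oneS ⊕ u) ⋆ dS (partialP N) ≋ aS ⋆ (dS u ⋆ partialP N) ⊕ ⊝ partialP-err N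
    partialP-ode zero = begin≋
        (oneS ⊕ u) ⋆ dS (partialP 0) ≋⟨ ⋆-congʳ (oneS ⊕ u) (dS-zero {partialP 0} (mk≋ λ n → refl)) ⟩
        (oneS ⊕ u) ⋆ zeroS ≋⟨ solveS 4 (λ x a d q → x ⊠ conS (+ 0) ≔ a ⊠ (d ⊠ conS (+ 0)) ⊞ ⊟ (conS (+ 0) ⊠ q)) SRR.refl (oneS ⊕ u) aS (dS u) (powS u 0 ⋆ dS u) ⟩
        aS ⋆ (dS u ⋆ zeroS) ⊕ ⊝ (zeroS ⋆ (powS u 0 ⋆ dS u)) ≋⟨ SRR.+-cong (⋆-congʳ aS (⋆-congʳ (dS u) (≋-refl {zeroS}))) (SRR.-‿cong (⋆-congˡ (powS u 0 ⋆ dS u) (≋-sym (≋-trans (const-cong (zeroˡ (binomC a 0))) const-0)))) ⟩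
        aS ⋆ (dS u ⋆ partialP 0) ⊕ ⊝ partialP-err 0 ∎≋
    partialP-ode (suc N) = begin≋
        (oneS ⊕ u) ⋆ dS (partialP N ⊕ bTerm N ⋆ powS u N) ≋⟨ ⋆-congʳ (oneS ⊕ u) (≋-trans (dS-⊕ (partialP N) (bTerm N ⋆ powS u N)) (⊕-congʳ (dS (partialP N)) (dS-const (binomC a N) (powS u N)))) ⟩
        (oneS ⊕ u) ⋆ (dS (partialP N) ⊕ bTerm N ⋆ dS (powS u N)) ≋⟨ SRR.distribˡ (oneS ⊕ u) (dS (partialP N)) (bTerm N ⋆ dS (powS u N)) ⟩
        (oneS ⊕ u) ⋆ dS (partialP N) ⊕ (oneS ⊕ u) ⋆ (bTerm N ⋆ dS (powS u N)) ≋⟨ ⊕-congˡ ((oneS ⊕ u) ⋆ (bTerm N ⋆ dS (powS u N))) (partialP-ode N) ⟩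
        (aS ⋆ (dS u ⋆ partialP N) ⊕ ⊝ partialP-err N) ⊕ (oneS ⊕ u) ⋆ (bTerm N ⋆ dS (powS u N)) ≋⟨ partialP-step N ⟩
        aS ⋆ (dS u ⋆ (partialP N ⊕ bTerm N ⋆ powS u N)) ⊕ ⊝ partialP-err (suc N) ∎≋

    P : Series
    P = toddPow a

    P≈partialP : ∀ m N → m ℕ.< N → P m ≈ partialP N m
    P≈partialP m N m<N = trans (trunc-pow (binomC a) u u0 m N m<N) (Σ-cong N (λ j → sym (app (const-⋆ (binomC a j) (powS u j)) m)))

    P0 : P 0 ≈ 1#
    P0 = trans (+-identityˡ _) (trans (*-identityʳ _) (binom0 a))

    T⋆dP : ∀ n → (T ⋆ dS P) n ≈ (aS ⋆ (dS T ⋆ P)) n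
    T⋆dP n = begin
      (T ⋆ dS P) n ≈⟨ ⋆-truncʳ {dS P} {dS (partialP N)} T n (λ i i≤n → *-congˡ (P≈partialP (suc i) N (s≤s (s≤s i≤n)))) ⟩
      (T ⋆ dS (partialP N)) n ≈⟨ sym (app (⋆-congˡ (dS (partialP N)) T-u) n) ⟩
      ((oneS ⊕ u) ⋆ dS (partialP N)) n ≈⟨ app (partialP-ode N) n ⟩
      (aS ⋆ (dS u ⋆ partialP N)) n + - partialP-err N n ≈⟨ +-congˡ (trans (-‿cong errn) -0#≈0#) ⟩
      (aS ⋆ (dS u ⋆ partialP N)) n + 0# ≈⟨ +-identityʳ _ ⟩
      (aS ⋆ (dS u ⋆ partialP N)) n ≈⟨ app (const-⋆ a (dS u ⋆ partialP N)) n ⟩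
      a * (dS u ⋆ partialP N) n ≈⟨ *-congˡ (app (⋆-congˡ (partialP N) du-dT) n) ⟩
      a * (dS T ⋆ partialP N) n ≈⟨ *-congˡ (⋆-truncʳ (dS T) n (λ i i≤n → sym (P≈partialP i N (ℕₚ.≤-trans (s≤s i≤n) (ℕₚ.n≤1+n (suc n)))))) ⟩
      a * (dS T ⋆ P) n ≈⟨ sym (app (const-⋆ a (dS T ⋆ P)) n) ⟩
      (aS ⋆ (dS T ⋆ P)) n ∎
      where
      N = suc (suc n)
      errn : partialP-err N n ≈ 0#
      errn = trans (app (const-⋆ (nat N * binomC a N) (powS u (N ∸ 1) ⋆ dS u)) n) (trans (*-congˡ (⋆-ord (powS u (suc n)) (dS u) n (λ i i≤n → powS-ord u u0 (suc n) i (s≤s i≤n)))) (zeroʳ _))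

  -- K = T'/T = T' E, the logarithmic derivative of T
  K : Series
  K = dS T ⋆ E

  Mc : Carrier → Series
  Mc a = constS a ⋆ K

  P-ode : ∀ a → dS (toddPow a) ≋ Mc a ⋆ toddPow a
  P-ode a = begin≋
    dS Pa ≋⟨ SRR.sym (SRR.*-identityˡ (dS Pa)) ⟩
    oneS ⋆ dS Pa ≋⟨ ⋆-congˡ (dS Pa) (≋-sym E⋆T) ⟩
    (E ⋆ T) ⋆ dS Pa ≋⟨ ⋆-assoc E T (dS Pa) ⟩
    E ⋆ (T ⋆ dS Pa) ≋⟨ ⋆-congʳ E (mk≋ (T⋆dP a)) ⟩
    E ⋆ (constS a ⋆ (dS T ⋆ Pa)) ≋⟨ solveS 4 (λ e x d p → e ⊠ (x ⊠ (d ⊠ p)) ≔ (x ⊠ (d ⊠ e)) ⊠ p) SRR.refl E (constS a) (dS T) Pa ⟩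
    Mc a ⋆ Pa ∎≋
    where Pa = toddPow a

  pow-cong : ∀ {x y} n → x ≈ y → pow x n ≈ pow y n
  pow-cong zero e = refl
  pow-cong (suc n) e = *-cong e (pow-cong n e)

  pow-+ : ∀ x m n → pow x (m ℕ.+ n) ≈ pow x m * pow x n
  pow-+ x zero n = sym (*-identityˡ _)
  pow-+ x (suc m) n = trans (*-congˡ (pow-+ x m n)) (sym (*-assoc _ _ _))

  pow-* : ∀ x y n → pow (x * y) n ≈ pow x n * pow y n
  pow-* x y zero = sym (*-identityˡ _)
  pow-* x y (suc n) = trans (*-congˡ (pow-* x y n)) (solve 4 (λ a b c d → (a :* b) :* (c :* d) := (a :* c) :* (b :* d)) refl x y _ _)

  pow-1 : ∀ n → pow 1# n ≈ 1#
  pow-1 zero = refl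
  pow-1 (suc n) = trans (*-identityˡ _) (pow-1 n)

  m1 : Carrier
  m1 = - 1#

  m1m1 : m1 * m1 ≈ 1#
  m1m1 = solve 0 (:- con (+ 1) :* :- con (+ 1) := con (+ 1)) refl

  m1-sq : ∀ n → pow m1 n * pow m1 n ≈ 1#
  m1-sq n = trans (sym (pow-* m1 m1 n)) (trans (pow-cong n m1m1) (pow-1 n))

  negS : Series → Series
  negS f n = pow m1 n * f n

  negS-cong : ∀ {f g} → f ≋ g → negS f ≋ negS g
  negS-cong e = mk≋ λ n → *-congˡ (app e n)

  negS-⋆ : ∀ f g → negS (f ⋆ g) ≋ negS f ⋆ negS g
  negS-⋆ f g = mk≋ λ n → trans (Σ-*ˡ (suc n) _ _) (Σ-cong< (suc n) (λ i i<n → trans (*-congʳ (trans (pow-cong n refl) (trans (reflexive (≡.cong (pow m1) (≡.sym (ℕₚ.m+[n∸m]≡n (ℕₚ.≤-pred i<n))))) (pow-+ m1 i (n ∸ i))))) (solve 4 (λ a b x y → (a :* b) :* (x :* y) := (a :* x) :* (b :* y)) refl _ _ _ _)))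

  negS-⊕ : ∀ f g → negS (f ⊕ g) ≋ negS f ⊕ negS g
  negS-⊕ f g = mk≋ λ n → distribˡ _ _ _

  negS-⊝ : ∀ f → negS (⊝ f) ≋ ⊝ negS f
  negS-⊝ f = mk≋ λ n → sym (-‿distribʳ-* _ _)

  negS-const : ∀ a → negS (constS a) ≋ constS a
  negS-const a = mk≋ λ { zero → *-identityˡ _ ; (suc n) → zeroʳ _ }

  negS-one : negS oneS ≋ oneS
  negS-one = mk≋ λ { zero → *-identityˡ _ ; (suc n) → zeroʳ _ }

  negS-negS : ∀ f → negS (negS f) ≋ f
  negS-negS f = mk≋ λ n → trans (sym (*-assoc _ _ _)) (trans (*-congʳ (m1-sq n)) (*-identityˡ _))

  dS-negS : ∀ f → dS (negS f) ≋ ⊝ negS (dS f)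
  dS-negS f = mk≋ λ n → solve 3 (λ k p x → k :* ((:- con (+ 1) :* p) :* x) := :- (p :* (k :* x))) refl (nat (suc n)) (pow m1 n) (f (suc n))

  expS : Carrier → Series
  expS x n = pow x n * invℕ (n !)

  exp0 : ∀ x → expS x 0 ≈ 1#
  exp0 x = trans (*-identityˡ _) inv1

  dS-exp : ∀ x → dS (expS x) ≋ constS x ⋆ expS x
  dS-exp x = ≋-sym (≋-trans (const-⋆ x (expS x)) (mk≋ λ n → sym (begin
    nat (suc n) * ((x * pow x n) * invℕ (suc n !)) ≈⟨ solve 4 (λ k x p i → k :* ((x :* p) :* i) := x :* (p :* (k :* i))) refl _ x _ _ ⟩
    x * (pow x n * (nat (suc n) * invℕ (suc n !))) ≈⟨ *-congˡ (*-congˡ (invfact-step n)) ⟩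
    x * (pow x n * invℕ (n !)) ∎)))

  expS-cong : ∀ {x y} → x ≈ y → expS x ≋ expS y
  expS-cong e = mk≋ λ n → *-congʳ (pow-cong n e)

  -- e^{xt} e^{yt} = e^{(x+y)t}, as both sides solve Q' = (x+y) Q
  exp-add : ∀ x y → expS x ⋆ expS y ≋ expS (x + y)
  exp-add x y = ode-unique (constS (x + y)) (expS x ⋆ expS y) (expS (x + y))
    (begin≋
      dS (expS x ⋆ expS y) ≋⟨ leibniz (expS x) (expS y) ⟩
      dS (expS x) ⋆ expS y ⊕ expS x ⋆ dS (expS y) ≋⟨ ⊕-cong (⋆-congˡ (expS y) (dS-exp x)) (⋆-congʳ (expS x) (dS-exp y)) ⟩
      (constS x ⋆ expS x) ⋆ expS y ⊕ expS x ⋆ (constS y ⋆ expS y) ≋⟨ solveS 4 (λ a b p q → (a ⊠ p) ⊠ q ⊞ p ⊠ (b ⊠ q) ≔ (a ⊞ b) ⊠ (p ⊠ q)) SRR.refl (constS x) (constS y) (expS x) (expS y) ⟩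
      (constS x ⊕ constS y) ⋆ (expS x ⋆ expS y) ≋⟨ ⋆-congˡ (expS x ⋆ expS y) (≋-sym (const-+ x y)) ⟩
      constS (x + y) ⋆ (expS x ⋆ expS y) ∎≋)
    (dS-exp (x + y))
    (trans (+-identityˡ _) (trans (*-cong (exp0 x) (exp0 y)) (trans (*-identityˡ _) (sym (exp0 (x + y))))))

  exp-zero : expS 0# ≋ oneS
  exp-zero = mk≋ λ { zero → exp0 0# ; (suc n) → trans (*-congʳ (zeroˡ _)) (zeroˡ _) }

  negS-exp : ∀ x → negS (expS x) ≋ expS (- x)
  negS-exp x = mk≋ λ n → trans (sym (*-assoc _ _ _)) (*-congʳ (trans (sym (pow-* m1 x n)) (pow-cong n (trans (sym (-‿distribˡ-* _ _)) (-‿cong (*-identityˡ x))))))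

  -- Multiplication by t, used to clear the denominator of E = (eᵗ - 1)/t.

  tS : Series → Series
  tS f zero = 0#
  tS f (suc n) = f n

  tS-cong : ∀ {f g} → f ≋ g → tS f ≋ tS g
  tS-cong e = mk≋ λ { zero → refl ; (suc n) → app e n }

  tS-⋆ : ∀ f g → tS (f ⋆ g) ≋ tS f ⋆ g
  tS-⋆ f g = mk≋ λ { zero → sym (trans (+-identityˡ _) (zeroˡ _))
                   ; (suc n) → sym (trans (Σ-head (suc n) _) (trans (+-congʳ (zeroˡ _)) (+-identityˡ _))) }

  tS-negS : ∀ f → tS (negS f) ≋ ⊝ negS (tS f)
  tS-negS f = mk≋ λ { zero → sym (trans (-‿cong (zeroʳ _)) -0#≈0#)
                    ; (suc n) → solve 2 (λ p x → p :* x := :- ((:- con (+ 1) :* p) :* x)) refl (pow m1 n) (f n) }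

  tS-inj : ∀ {f g} → tS f ≋ tS g → f ≋ g
  tS-inj e = mk≋ λ n → app e (suc n)

  e1 : Series
  e1 = expS 1#

  tS-E : tS E ≋ e1 ⊕ ⊝ oneS
  tS-E = mk≋ λ { zero → sym (trans (+-congʳ (exp0 1#)) (-‿inverseʳ _))
               ; (suc n) → sym (trans (+-congˡ -0#≈0#) (trans (+-identityʳ _) (trans (*-congʳ (pow-1 (suc n))) (*-identityˡ _)))) }

  -- E(t) = eᵗ E(-t), since -t E(-t) = e^{-t} - 1
  E-reflection : E ≋ e1 ⋆ negS E
  E-reflection = tS-inj (≋-sym (begin≋
    tS (e1 ⋆ negS E) ≋⟨ ≋-trans (tS-cong (⋆-comm e1 (negS E))) (tS-⋆ (negS E) e1) ⟩
    tS (negS E) ⋆ e1 ≋⟨ ⋆-congˡ e1 (≋-trans (tS-negS E) (SRR.-‿cong (≋-trans (negS-cong tS-E) (≋-trans (negS-⊕ e1 (⊝ oneS)) (⊕-cong (negS-exp 1#) (≋-trans (negS-⊝ oneS) (SRR.-‿cong negS-one))))))) ⟩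
    (⊝ (expS m1 ⊕ ⊝ oneS)) ⋆ e1 ≋⟨ solveS 2 (λ a b → (⊟ (a ⊞ ⊟ conS (+ 1))) ⊠ b ≔ b ⊞ ⊟ (a ⊠ b)) SRR.refl (expS m1) e1 ⟩
    e1 ⊕ ⊝ (expS m1 ⋆ e1) ≋⟨ ⊕-congʳ e1 (SRR.-‿cong (≋-trans (exp-add m1 1#) (≋-trans (expS-cong (-‿inverseˡ 1#)) exp-zero))) ⟩
    e1 ⊕ ⊝ oneS ≋⟨ ≋-sym tS-E ⟩
    tS E ∎≋))

  NE NT : Series
  NE = negS E
  NT = negS T

  NE⋆NT : NE ⋆ NT ≋ oneS
  NE⋆NT = ≋-trans (≋-sym (negS-⋆ E T)) (≋-trans (negS-cong E⋆T) negS-one)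

  T-reflection : NT ≋ e1 ⋆ T
  T-reflection = ≋-sym (begin≋
    e1 ⋆ T ≋⟨ solveS 4 (λ e t a b → e ⊠ t ≔ (e ⊠ t) ⊠ conS (+ 1)) SRR.refl e1 T NE NT ⟩
    (e1 ⋆ T) ⋆ oneS ≋⟨ ⋆-congʳ (e1 ⋆ T) (≋-sym NE⋆NT) ⟩
    (e1 ⋆ T) ⋆ (NE ⋆ NT) ≋⟨ solveS 4 (λ e t a b → (e ⊠ t) ⊠ (a ⊠ b) ≔ ((e ⊠ a) ⊠ t) ⊠ b) SRR.refl e1 T NE NT ⟩
    ((e1 ⋆ NE) ⋆ T) ⋆ NT ≋⟨ ⋆-congˡ NT (⋆-congˡ T (≋-sym E-reflection)) ⟩
    (E ⋆ T) ⋆ NT ≋⟨ ⋆-congˡ NT E⋆T ⟩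
    oneS ⋆ NT ≋⟨ ⋆-identityˡ NT ⟩
    NT ∎≋)

  dS-e1 : dS e1 ≋ e1
  dS-e1 = ≋-trans (dS-exp 1#) (≋-trans (⋆-congˡ e1 const-1) (⋆-identityˡ e1))

  K-reflection : ⊝ negS K ≋ oneS ⊕ K
  K-reflection = begin≋
    ⊝ negS K ≋⟨ SRR.-‿cong (negS-⋆ (dS T) E) ⟩
    ⊝ (negS (dS T) ⋆ NE) ≋⟨ solveS 2 (λ a b → ⊟ (a ⊠ b) ≔ (⊟ a) ⊠ b) SRR.refl (negS (dS T)) NE ⟩
    (⊝ negS (dS T)) ⋆ NE ≋⟨ ⋆-congˡ NE d-NT ⟩
    (e1 ⋆ T ⊕ e1 ⋆ dS T) ⋆ NE ≋⟨ solveS 4 (λ e t d a → (e ⊠ t ⊞ e ⊠ d) ⊠ a ≔ (e ⊠ a) ⊠ t ⊞ d ⊠ (e ⊠ a)) SRR.refl e1 T (dS T) NE ⟩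
    (e1 ⋆ NE) ⋆ T ⊕ dS T ⋆ (e1 ⋆ NE) ≋⟨ ⊕-cong (≋-trans (⋆-congˡ T (≋-sym E-reflection)) E⋆T) (⋆-congʳ (dS T) (≋-sym E-reflection)) ⟩
    oneS ⊕ K ∎≋
    where
    d-NT : ⊝ negS (dS T) ≋ e1 ⋆ T ⊕ e1 ⋆ dS T
    d-NT = begin≋
      ⊝ negS (dS T) ≋⟨ ≋-sym (dS-negS T) ⟩
      dS NT ≋⟨ dS-cong T-reflection ⟩
      dS (e1 ⋆ T) ≋⟨ leibniz e1 T ⟩
      dS e1 ⋆ T ⊕ e1 ⋆ dS T ≋⟨ ⊕-congˡ (e1 ⋆ dS T) (⋆-congˡ T dS-e1) ⟩
      e1 ⋆ T ⊕ e1 ⋆ dS T ∎≋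

  -- Reflection formula P_a(-t) = e^{at} P_a(t): both sides solve
  -- Q' = a (1 + K) Q, by K-reflection.
  P-reflection : ∀ a → negS (toddPow a) ≋ expS a ⋆ toddPow a
  P-reflection a = ode-unique (constS a ⋆ (oneS ⊕ K)) (negS Pa) (expS a ⋆ Pa)
    (begin≋
      dS (negS Pa) ≋⟨ dS-negS Pa ⟩
      ⊝ negS (dS Pa) ≋⟨ SRR.-‿cong (negS-cong (P-ode a)) ⟩
      ⊝ negS ((constS a ⋆ K) ⋆ Pa) ≋⟨ SRR.-‿cong (≋-trans (negS-⋆ (constS a ⋆ K) Pa) (⋆-congˡ (negS Pa) (≋-trans (negS-⋆ (constS a) K) (⋆-congˡ (negS K) (negS-const a))))) ⟩
      ⊝ ((constS a ⋆ negS K) ⋆ negS Pa) ≋⟨ solveS 3 (λ a k p → ⊟ ((a ⊠ k) ⊠ p) ≔ (a ⊠ (⊟ k)) ⊠ p) SRR.refl (constS a) (negS K) (negS Pa) ⟩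
      (constS a ⋆ (⊝ negS K)) ⋆ negS Pa ≋⟨ ⋆-congˡ (negS Pa) (⋆-congʳ (constS a) K-reflection) ⟩
      (constS a ⋆ (oneS ⊕ K)) ⋆ negS Pa ∎≋)
    (begin≋
      dS (expS a ⋆ Pa) ≋⟨ leibniz (expS a) Pa ⟩
      dS (expS a) ⋆ Pa ⊕ expS a ⋆ dS Pa ≋⟨ ⊕-cong (⋆-congˡ Pa (dS-exp a)) (⋆-congʳ (expS a) (P-ode a)) ⟩
      (constS a ⋆ expS a) ⋆ Pa ⊕ expS a ⋆ ((constS a ⋆ K) ⋆ Pa) ≋⟨ solveS 4 (λ a e k p → (a ⊠ e) ⊠ p ⊞ e ⊠ ((a ⊠ k) ⊠ p) ≔ (a ⊠ (conS (+ 1) ⊞ k)) ⊠ (e ⊠ p)) SRR.refl (constS a) (expS a) K Pa ⟩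
      (constS a ⋆ (oneS ⊕ K)) ⋆ (expS a ⋆ Pa) ∎≋)
    (trans (*-identityˡ _) (sym (trans (+-identityˡ _) (trans (*-congʳ (exp0 a)) (*-identityˡ _)))))
    where Pa = toddPow a

  -- E' = -K E, differentiating T E = 1
  dE : dS E ≋ ⊝ (K ⋆ E)
  dE = begin≋
    dS E ≋⟨ ≋-sym (⋆-identityˡ (dS E)) ⟩
    oneS ⋆ dS E ≋⟨ ⋆-congˡ (dS E) (≋-sym E⋆T) ⟩
    (E ⋆ T) ⋆ dS E ≋⟨ ⋆-assoc E T (dS E) ⟩
    E ⋆ (T ⋆ dS E) ≋⟨ ⋆-congʳ E (SeriesGroup.inverseʳ-unique (dS T ⋆ E) (T ⋆ dS E) z) ⟩
    E ⋆ (⊝ (dS T ⋆ E)) ≋⟨ solveS 3 (λ e d f → e ⊠ (⊟ (d ⊠ f)) ≔ ⊟ ((d ⊠ e) ⊠ f)) SRR.refl E (dS T) E ⟩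
    ⊝ (K ⋆ E) ∎≋
    where
    module SeriesGroup = GroupProperties SRR.+-group
    z : dS T ⋆ E ⊕ T ⋆ dS E ≋ zeroS
    z = ≋-trans (≋-sym (leibniz T E)) (≋-trans (dS-cong T⋆E) dS-one)

  -- Shift formula P_a E = P_{a-1}: both sides solve Q' = (a - 1) K Q.
  P-shift : ∀ a → toddPow a ⋆ E ≋ toddPow (a - 1#)
  P-shift a = ode-unique (Mc (a - 1#)) (Pa ⋆ E) (toddPow (a - 1#))
    (begin≋
      dS (Pa ⋆ E) ≋⟨ leibniz Pa E ⟩
      dS Pa ⋆ E ⊕ Pa ⋆ dS E ≋⟨ ⊕-cong (⋆-congˡ E (P-ode a)) (⋆-congʳ Pa dE) ⟩
      ((constS a ⋆ K) ⋆ Pa) ⋆ E ⊕ Pa ⋆ (⊝ (K ⋆ E)) ≋⟨ solveS 4 (λ a k p e → ((a ⊠ k) ⊠ p) ⊠ e ⊞ p ⊠ (⊟ (k ⊠ e)) ≔ ((a ⊞ ⊟ conS (+ 1)) ⊠ k) ⊠ (p ⊠ e)) SRR.refl (constS a) K Pa E ⟩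
      ((constS a ⊕ ⊝ oneS) ⋆ K) ⋆ (Pa ⋆ E) ≋⟨ ⋆-congˡ (Pa ⋆ E) (⋆-congˡ K (≋-sym (≋-trans (const-+ a (- 1#)) (⊕-congʳ (constS a) (≋-trans (const-neg 1#) (SRR.-‿cong const-1)))))) ⟩
      Mc (a - 1#) ⋆ (Pa ⋆ E) ∎≋)
    (P-ode (a - 1#))
    (trans (+-identityˡ _) (trans (*-cong (P0 a) E0) (trans (*-identityˡ _) (sym (P0 (a - 1#))))))
    where Pa = toddPow a

  -- Polynomials are the series of finite support: Bnd N f says that f
  -- vanishes in all degrees ≥ N.
  Bnd : ℕ → Series → Set ℓ
  Bnd N f = ∀ i → N ℕ.≤ i → f i ≈ 0#

  Bnd-cong : ∀ {N f g} → f ≋ g → Bnd N f → Bnd N g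
  Bnd-cong e b i le = trans (sym (app e i)) (b i le)

  Bnd-weaken : ∀ {N M f} → N ℕ.≤ M → Bnd N f → Bnd M f
  Bnd-weaken le b i M≤i = b i (ℕₚ.≤-trans le M≤i)

  Bnd-· : ∀ {N f} a → Bnd N f → Bnd N (a ·ₛ f)
  Bnd-· a b i le = trans (*-congˡ (b i le)) (zeroʳ _)

  Bnd-ΣS : ∀ {N} M F → (∀ j → Bnd N (F j)) → Bnd N (ΣS M F)
  Bnd-ΣS M F b i le = Σ-zero M (λ j _ → b j i le)

  Bnd-dS : ∀ {N f} → Bnd N f → Bnd N (dS f)
  Bnd-dS b i le = trans (*-congˡ (b (suc i) (ℕₚ.m≤n⇒m≤1+n le))) (zeroʳ _)

  Bnd-negS : ∀ {N f} → Bnd N f → Bnd N (negS f)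
  Bnd-negS b i le = trans (*-congˡ (b i le)) (zeroʳ _)

  Bnd0 : ∀ {f} → Bnd 0 f → f ≋ zeroS
  Bnd0 b = mk≋ λ i → b i z≤n

  dI : ℕ → Series → Series
  dI zero f = f
  dI (suc k) f = dS (dI k f)

  dI-cong : ∀ k {f g} → f ≋ g → dI k f ≋ dI k g
  dI-cong zero e = e
  dI-cong (suc k) e = dS-cong (dI-cong k e)

  dI-⊕ : ∀ k f g → dI k (f ⊕ g) ≋ dI k f ⊕ dI k g
  dI-⊕ zero f g = ≋-refl
  dI-⊕ (suc k) f g = ≋-trans (dS-cong (dI-⊕ k f g)) (dS-⊕ (dI k f) (dI k g))

  dI-· : ∀ k a f → dI k (a ·ₛ f) ≋ a ·ₛ dI k f
  dI-· zero a f = ≋-refl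
  dI-· (suc k) a f = ≋-trans (dS-cong (dI-· k a f)) (dS-· a (dI k f))

  dI-⊝ : ∀ k f → dI k (⊝ f) ≋ ⊝ dI k f
  dI-⊝ zero f = ≋-refl
  dI-⊝ (suc k) f = ≋-trans (dS-cong (dI-⊝ k f)) (dS-⊝ (dI k f))

  dI-zero : ∀ k {f} → f ≋ zeroS → dI k f ≋ zeroS
  dI-zero zero e = e
  dI-zero (suc k) e = dS-zero (dI-zero k e)

  dI-ΣS : ∀ k M F → dI k (ΣS M F) ≋ ΣS M (λ j → dI k (F j))
  dI-ΣS k zero F = dI-zero k (mk≋ λ n → refl)
  dI-ΣS k (suc M) F = ≋-trans (dI-⊕ k (ΣS M F) (F M)) (⊕-congˡ (dI k (F M)) (dI-ΣS k M F))

  dI-dS : ∀ k f → dI k (dS f) ≋ dS (dI k f)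
  dI-dS zero f = ≋-refl
  dI-dS (suc k) f = dS-cong (dI-dS k f)

  dI-add : ∀ k j f → dI j (dI k f) ≋ dI (k ℕ.+ j) f
  dI-add k zero f = reflexive≋ (≡.cong (λ m → dI m f) (≡.sym (ℕₚ.+-identityʳ k)))
  dI-add k (suc j) f = ≋-trans (dS-cong (dI-add k j f)) (reflexive≋ (≡.cong (λ m → dI m f) (≡.sym (ℕₚ.+-suc k j))))

  Bnd-dI : ∀ {N f} k → Bnd N f → Bnd (N ∸ k) (dI k f)
  Bnd-dI zero b = b
  Bnd-dI {N} (suc k) b i le = trans (*-congˡ (Bnd-dI k b (suc i) bound)) (zeroʳ _)
    where
    bound : N ∸ k ℕ.≤ suc i
    bound = ℕₚ.≤-trans (∸-suc-≤ N k) (s≤s le)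
      where
      ∸-suc-≤ : ∀ N k → N ∸ k ℕ.≤ suc (N ∸ suc k)
      ∸-suc-≤ zero k = ℕₚ.≤-trans (ℕₚ.≤-reflexive (ℕₚ.0∸n≡0 k)) z≤n
      ∸-suc-≤ (suc N) zero = s≤s (ℕₚ.≤-reflexive ≡.refl)
      ∸-suc-≤ (suc N) (suc k) = ∸-suc-≤ N k

  dI-vanish : ∀ {N f} k → Bnd N f → N ℕ.≤ k → dI k f ≋ zeroS
  dI-vanish {N} k b le = Bnd0 (Bnd-weaken (ℕₚ.≤-reflexive (ℕₚ.m≤n⇒m∸n≡0 le)) (Bnd-dI k b))

  Bnd-dI-≤ : ∀ {N f} k → Bnd N f → Bnd N (dI k f)
  Bnd-dI-≤ {N} k b = Bnd-weaken (ℕₚ.m∸n≤m N k) (Bnd-dI k b)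

  ΣS-⊕ : ∀ M F G → ΣS M (λ j → F j ⊕ G j) ≋ ΣS M F ⊕ ΣS M G
  ΣS-⊕ M F G = mk≋ λ n → Σ-+ M _ _

  ΣS-· : ∀ M a F → a ·ₛ ΣS M F ≋ ΣS M (λ j → a ·ₛ F j)
  ΣS-· M a F = mk≋ λ n → Σ-*ˡ M a _

  ΣS-swap : ∀ M K (F : ℕ → ℕ → Series) → ΣS M (λ i → ΣS K (F i)) ≋ ΣS K (λ j → ΣS M (λ i → F i j))
  ΣS-swap M K F = mk≋ λ n → Σ-swap M K (λ i j → F i j n)

  ΣS-⊝ : ∀ M F → ΣS M (λ j → ⊝ F j) ≋ ⊝ ΣS M F
  ΣS-⊝ M F = mk≋ λ n → Σ-neg M _

  ΣS-cong< : ∀ M {F G} → (∀ j → j ℕ.< M → F j ≋ G j) → ΣS M F ≋ ΣS M G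
  ΣS-cong< M e = mk≋ λ n → Σ-cong< M (λ j lt → app (e j lt) n)

  ΣS-ext : ∀ A B {F} → (∀ j → A ℕ.≤ j → F j ≋ zeroS) → A ℕ.≤ B → ΣS B F ≋ ΣS A F
  ΣS-ext A B e le = mk≋ λ n → Σ-ext A B (λ j lt → app (e j lt) n) le

  -- For a series φ, the operator φ(D) = Σ_{k<N} φₖ Dᵏ on series of support
  -- below N.
  OP : ℕ → Series → Series → Series
  OP N φ f = ΣS N (λ k → φ k ·ₛ dI k f)

  OP-cong : ∀ N {φ ψ f g} → φ ≋ ψ → f ≋ g → OP N φ f ≋ OP N ψ g
  OP-cong N eφ ef = ΣS-cong N (λ k → ·-cong (app eφ k) (dI-cong k ef))

  OP-⊕ : ∀ N φ f g → OP N φ (f ⊕ g) ≋ OP N φ f ⊕ OP N φ g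
  OP-⊕ N φ f g = ≋-trans (ΣS-cong N (λ k → ≋-trans (·-cong refl (dI-⊕ k f g)) (·-⊕ (φ k) _ _))) (ΣS-⊕ N _ _)

  OP-· : ∀ N φ a f → OP N φ (a ·ₛ f) ≋ a ·ₛ OP N φ f
  OP-· N φ a f = ≋-trans (ΣS-cong N (λ k → ≋-trans (·-cong refl (dI-· k a f)) (≋-trans (·-· (φ k) a _) (≋-trans (·-cong (*-comm _ _) ≋-refl) (≋-sym (·-· a (φ k) _)))))) (≋-sym (ΣS-· N a _))

  OP-⊝ : ∀ N φ f → OP N φ (⊝ f) ≋ ⊝ OP N φ f
  OP-⊝ N φ f = ≋-trans (ΣS-cong N (λ k → ≋-trans (·-cong refl (dI-⊝ k f)) (mk≋ λ n → sym (-‿distribʳ-* _ _)))) (ΣS-⊝ N _)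

  OP-ΣS : ∀ N φ M F → OP N φ (ΣS M F) ≋ ΣS M (λ j → OP N φ (F j))
  OP-ΣS N φ M F = ≋-trans (ΣS-cong N (λ k → ≋-trans (·-cong refl (dI-ΣS k M F)) (ΣS-· M (φ k) _))) (ΣS-swap N M _)

  OP-⊕φ : ∀ N φ ψ f → OP N (φ ⊕ ψ) f ≋ OP N φ f ⊕ OP N ψ f
  OP-⊕φ N φ ψ f = ≋-trans (ΣS-cong N (λ k → mk≋ λ n → distribʳ _ _ _)) (ΣS-⊕ N _ _)

  OP-ext : ∀ N M φ {f} → Bnd N f → N ℕ.≤ M → OP M φ f ≋ OP N φ f
  OP-ext N M φ {f} b le = ΣS-ext N M (λ k N≤k → ≋-trans (·-cong refl (dI-vanish k b N≤k)) (mk≋ λ n → zeroʳ _)) le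

  Bnd-OP : ∀ {N f} M φ → Bnd N f → Bnd N (OP M φ f)
  Bnd-OP M φ b = Bnd-ΣS M _ (λ k → Bnd-· (φ k) (Bnd-dI-≤ k b))

  OP-dS : ∀ N φ f → dS (OP N φ f) ≋ OP N φ (dS f)
  OP-dS zero φ f = mk≋ λ n → zeroʳ _
  OP-dS (suc N) φ f = ≋-trans (dS-⊕ (OP N φ f) (φ N ·ₛ dI N f)) (⊕-cong (OP-dS N φ f) (≋-trans (dS-· (φ N) (dI N f)) (·-cong refl (≋-sym (dI-dS N f)))))

  OP-dI : ∀ j N φ f → dI j (OP N φ f) ≋ OP N φ (dI j f)
  OP-dI zero N φ f = ≋-refl
  OP-dI (suc j) N φ f = ≋-trans (dS-cong (OP-dI j N φ f)) (OP-dS N φ (dI j f))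

  OP-one : ∀ N {f} → Bnd N f → OP N oneS f ≋ f
  OP-one zero b = ≋-sym (Bnd0 b)
  OP-one (suc N) {f} b = mk≋ λ n → trans (Σ-head N _) (trans (+-cong (*-identityˡ _) (Σ-zero N (λ k _ → zeroˡ _))) (+-identityʳ _))

  -- composition of operators is the product of their symbols:
  -- φ(D) (ψ(D) f) = (φ ψ)(D) f; the double sum is reindexed by Σ-tri
  OP-comp : ∀ N φ ψ {f} → Bnd N f → OP N φ (OP N ψ f) ≋ OP N (φ ⋆ ψ) f
  OP-comp N φ ψ {f} b = mk≋ λ n → begin
    Σ N (λ k → φ k * dI k (OP N ψ f) n) ≈⟨ Σ-cong N (λ k → *-congˡ (app (OP-dI k N ψ f) n)) ⟩
    Σ N (λ k → φ k * Σ N (λ j → ψ j * dI j (dI k f) n)) ≈⟨ Σ-cong N (λ k → trans (Σ-*ˡ N _ _) (Σ-cong N (λ j → *-congˡ (*-congˡ (app (dI-add k j f) n))))) ⟩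
    Σ N (λ i → Σ N (λ j → G n i j)) ≈⟨ Σ-cong< N (λ i i<N → Σ-ext (N ∸ i) N (λ j le → trans (*-congˡ (*-congˡ (app (dI-vanish (i ℕ.+ j) b (ℕₚ.≤-trans (ℕₚ.m≤n+m∸n N i) (ℕₚ.+-monoʳ-≤ i le))) n))) (trans (*-congˡ (zeroʳ _)) (zeroʳ _))) (ℕₚ.m∸n≤m N i)) ⟩
    Σ N (λ i → Σ (N ∸ i) (λ j → G n i j)) ≈⟨ sym (Σ-tri N (G n)) ⟩
    Σ N (λ K → Σ (suc K) (λ i → G n i (K ∸ i))) ≈⟨ Σ-cong N (λ K → Σ-cong< (suc K) (λ i i<K → *-congˡ (*-congˡ (reflexive (≡.cong (λ m → dI m f n) (ℕₚ.m+[n∸m]≡n (ℕₚ.≤-pred i<K))))))) ⟩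
    Σ N (λ K → Σ (suc K) (λ i → φ i * (ψ (K ∸ i) * dI K f n))) ≈⟨ Σ-cong N (λ K → trans (Σ-cong (suc K) (λ i → sym (*-assoc _ _ _))) (sym (Σ-*ʳ (suc K) _ _))) ⟩
    Σ N (λ K → (φ ⋆ ψ) K * dI K f n) ∎
    where
    G : ℕ → ℕ → ℕ → Carrier
    G n i j = φ i * (ψ j * dI (i ℕ.+ j) f n)

  -- Dᵏ (f(-x)) = (-1)ᵏ (Dᵏ f)(-x), with x ↦ -x acting on coefficients like t ↦ -t
  dI-negS : ∀ k f → dI k (negS f) ≋ pow m1 k ·ₛ negS (dI k f)
  dI-negS zero f = mk≋ λ n → sym (*-identityˡ _)
  dI-negS (suc k) f = ≋-trans (dS-cong (dI-negS k f)) (≋-trans (dS-· (pow m1 k) (negS (dI k f))) (≋-trans (·-cong refl (dS-negS (dI k f)))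
    (mk≋ λ n → solve 2 (λ p q → p :* (:- q) := (:- con (+ 1) :* p) :* q) refl (pow m1 k) _)))

  OP-negS : ∀ N φ f → OP N φ (negS f) ≋ negS (OP N (negS φ) f)
  OP-negS N φ f = mk≋ λ n → begin
    Σ N (λ k → φ k * dI k (negS f) n) ≈⟨ Σ-cong N (λ k → *-congˡ (app (dI-negS k f) n)) ⟩
    Σ N (λ k → φ k * (pow m1 k * (pow m1 n * dI k f n))) ≈⟨ Σ-cong N (λ k → solve 4 (λ a b c d → a :* (b :* (c :* d)) := c :* ((b :* a) :* d)) refl (φ k) (pow m1 k) (pow m1 n) _) ⟩
    Σ N (λ k → pow m1 n * (negS φ k * dI k f n)) ≈⟨ sym (Σ-*ˡ N _ _) ⟩
    pow m1 n * Σ N (λ k → negS φ k * dI k f n) ∎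

  Xs : Series
  Xs = tS oneS

  mono : ℕ → Series
  mono i = powS Xs i

  lin : Carrier → Series
  lin a = constS a ⊕ Xs

  dXs : dS Xs ≋ oneS
  dXs = mk≋ λ { zero → trans (*-identityʳ _) (+-identityʳ _) ; (suc n) → zeroʳ _ }

  Xs⋆ : ∀ g → Xs ⋆ g ≋ tS g
  Xs⋆ g = ≋-sym (≋-trans (tS-cong (≋-sym (⋆-identityˡ g))) (tS-⋆ oneS g))

  mono-suc : ∀ i → mono (suc i) ≋ tS (mono i)
  mono-suc i = Xs⋆ (mono i)

  mono-eq : ∀ i → mono i i ≈ 1#
  mono-eq zero = refl
  mono-eq (suc i) = trans (app (mono-suc i) (suc i)) (mono-eq i)

  mono-ne : ∀ i n → ¬ (i ≡ n) → mono i n ≈ 0#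
  mono-ne zero zero ne = ⊥-elim (ne ≡.refl)
  mono-ne zero (suc n) _ = refl
  mono-ne (suc i) zero _ = app (mono-suc i) 0
  mono-ne (suc i) (suc n) ne = trans (app (mono-suc i) (suc n)) (mono-ne i n (λ e → ne (≡.cong suc e)))

  Bnd-monomial : ∀ i → Bnd (suc i) (mono i)
  Bnd-monomial i n le = mono-ne i n (λ e → ℕₚ.<-irrefl e le)

  Σ-δ≥ : ∀ N (f : ℕ → Carrier) n → N ℕ.≤ n → Σ N (λ i → f i * mono i n) ≈ 0#
  Σ-δ≥ N f n le = Σ-zero N (λ i i<N → trans (*-congˡ (mono-ne i n (λ e → ℕₚ.<-irrefl e (ℕₚ.<-≤-trans i<N le)))) (zeroʳ _))

  Σ-δ< : ∀ N (f : ℕ → Carrier) n → n ℕ.< N → Σ N (λ i → f i * mono i n) ≈ f n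
  Σ-δ< (suc N) f n lt with n ℕ.≟ N
  ... | yes ≡.refl = trans (+-cong (Σ-δ≥ N f n ℕₚ.≤-refl) (trans (*-congˡ (mono-eq n)) (*-identityʳ _))) (+-identityˡ _)
  ... | no ne = trans (+-cong (Σ-δ< N f n (ℕₚ.≤∧≢⇒< (ℕₚ.≤-pred lt) ne)) (trans (*-congˡ (mono-ne N n (λ e → ne (≡.sym e)))) (zeroʳ _))) (+-identityʳ _)

  expand : ∀ N {f} → Bnd N f → f ≋ ΣS N (λ i → f i ·ₛ mono i)
  expand N {f} b = mk≋ λ n → go n (n ℕ.<? N)
    where
    go : ∀ n → Dec (n ℕ.< N) → f n ≈ Σ N (λ i → f i * mono i n)
    go n (yes lt) = sym (Σ-δ< N f n lt)
    go n (no nlt) = trans (b n (ℕₚ.≮⇒≥ nlt)) (sym (Σ-δ≥ N f n (ℕₚ.≮⇒≥ nlt)))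

  dS-mono : ∀ i → dS (mono (suc i)) ≋ nat (suc i) ·ₛ mono i
  dS-mono i = ≋-trans (dS-powS Xs i) (≋-trans (⋆-congʳ (natC (suc i)) (≋-trans (⋆-congʳ (mono i) dXs) (SRR.*-identityʳ (mono i)))) (≋-sym (nat-·ₛ (suc i) (mono i))))

  dS-mono0 : dS (mono 0) ≋ zeroS
  dS-mono0 = ≋-trans (dS-cong (powS0 Xs)) dS-one

  dI-mono : ∀ k i → dI k (mono i) ≋ nat (fallN i k) ·ₛ mono (i ∸ k)
  dI-mono zero i = mk≋ λ n → sym (trans (*-congʳ (+-identityʳ 1#)) (*-identityˡ _))
  dI-mono (suc k) i = ≋-trans (dS-cong (dI-mono k i)) (≋-trans (dS-· (nat (fallN i k)) (mono (i ∸ k))) (derivative-step (i ∸ k) ≡.refl))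
    where
    derivative-step : ∀ m → i ∸ k ≡ m → nat (fallN i k) ·ₛ dS (mono m) ≋ nat (fallN i (suc k)) ·ₛ mono (i ∸ suc k)
    derivative-step zero eq = ≋-trans (·-cong refl dS-mono0) (mk≋ λ n → trans (zeroʳ _) (sym (trans (*-congʳ (trans (nat-* (fallN i k) (i ∸ k)) (trans (*-congˡ (nat-cong eq)) (zeroʳ _)))) (zeroˡ _))))
    derivative-step (suc m) eq = ≋-trans (·-cong refl (dS-mono m)) (≋-trans (·-· _ _ _) (·-cong (trans (sym (*-congˡ (nat-cong eq))) (sym (nat-* (fallN i k) (i ∸ k)))) (reflexive≋ (≡.cong mono (≡.sym (∸suc i k m eq))))))
      where
      ∸suc : ∀ i k m → i ∸ k ≡ suc m → i ∸ suc k ≡ m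
      ∸suc zero k m eq = ⊥-elim (ℕₚ.0≢1+n (≡.trans (≡.sym (ℕₚ.0∸n≡0 k)) eq))
      ∸suc (suc i) zero m eq = ℕₚ.suc-injective eq
      ∸suc (suc i) (suc k) m eq = ∸suc i k m eq

  -- Since (k+1) e_a(k+1) = a e_a(k) for the coefficients
  -- of e^{at}, the operator e^{aD} satisfies e^{aD}(x g) = (a + x) e^{aD} g
  -- (taylor-step), hence e^{aD} xⁱ = (a + x)ⁱ and e^{aD} f = f(x + a).

  ΣS-head : ∀ M F → ΣS (suc M) F ≋ F 0 ⊕ ΣS M (λ k → F (suc k))
  ΣS-head M F = mk≋ λ n → Σ-head M _

  ⋆-ΣS : ∀ N h F → h ⋆ ΣS N F ≋ ΣS N (λ j → h ⋆ F j)
  ⋆-ΣS N h F = ≋-trans (⋆-comm h (ΣS N F)) (≋-trans (ΣS-⋆ N F h) (ΣS-cong N (λ j → ⋆-comm (F j) h)))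

  dS-X : ∀ G → dS (Xs ⋆ G) ≋ G ⊕ Xs ⋆ dS G
  dS-X G = ≋-trans (leibniz Xs G) (⊕-congˡ (Xs ⋆ dS G) (≋-trans (⋆-congˡ G dXs) (⋆-identityˡ G)))

  dI-X : ∀ k g → dI (suc k) (Xs ⋆ g) ≋ Xs ⋆ dI (suc k) g ⊕ nat (suc k) ·ₛ dI k g
  dI-X zero g = ≋-trans (dS-X g) (mk≋ λ n → trans (+-comm _ _) (+-congˡ (sym (trans (*-congʳ (+-identityʳ 1#)) (*-identityˡ _)))))
  dI-X (suc k) g = ≋-trans (dS-cong (dI-X k g)) (≋-trans (dS-⊕ (Xs ⋆ dI (suc k) g) (nat (suc k) ·ₛ dI k g))
    (≋-trans (⊕-cong (dS-X (dI (suc k) g)) (dS-· (nat (suc k)) (dI k g)))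
    (mk≋ λ n → solve 3 (λ h x m → (h :+ x) :+ m :* h := x :+ (con (+ 1) :+ m) :* h) refl (dI (suc k) g n) ((Xs ⋆ dI (suc (suc k)) g) n) (nat (suc k)))))

  exp-step : ∀ a k → expS a (suc k) * nat (suc k) ≈ a * expS a k
  exp-step a k = trans (solve 4 (λ a p i m → (a :* p :* i) :* m := a :* (p :* (m :* i))) refl a (pow a k) (invℕ (suc k !)) (nat (suc k))) (*-congˡ (*-congˡ (invfact-step k)))

  taylor-step : ∀ a M {g} → Bnd M g → OP (suc M) (expS a) (Xs ⋆ g) ≋ lin a ⋆ OP (suc M) (expS a) g
  taylor-step a M {g} b = begin≋
    OP (suc M) e (Xs ⋆ g) ≋⟨ ΣS-head M _ ⟩
    e 0 ·ₛ (Xs ⋆ g) ⊕ ΣS M (λ k → e (suc k) ·ₛ dI (suc k) (Xs ⋆ g))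
      ≋⟨ ⊕-congʳ (e 0 ·ₛ (Xs ⋆ g)) (≋-trans (ΣS-cong M (λ k → ≋-trans (·-cong refl (dI-X k g)) (≋-trans (·-⊕ (e (suc k)) _ _) (⊕-congʳ _ (≋-trans (·-· _ _ _) (·-cong (exp-step a k) ≋-refl)))))) (ΣS-⊕ M _ _)) ⟩
    e 0 ·ₛ (Xs ⋆ g) ⊕ (ΣS M (λ k → e (suc k) ·ₛ (Xs ⋆ dI (suc k) g)) ⊕ ΣS M (λ k → (a * e k) ·ₛ dI k g))
      ≋⟨ SRR.sym (SRR.+-assoc _ _ _) ⟩
    (e 0 ·ₛ (Xs ⋆ g) ⊕ ΣS M (λ k → e (suc k) ·ₛ (Xs ⋆ dI (suc k) g))) ⊕ ΣS M (λ k → (a * e k) ·ₛ dI k g)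
      ≋⟨ ⊕-cong (≋-sym (ΣS-head M (λ k → e k ·ₛ (Xs ⋆ dI k g)))) (≋-trans (ΣS-cong M (λ k → ≋-sym (·-· a (e k) (dI k g)))) (≋-sym (ΣS-· M a (λ k → e k ·ₛ dI k g)))) ⟩
    ΣS (suc M) (λ k → e k ·ₛ (Xs ⋆ dI k g)) ⊕ a ·ₛ OP M e g
      ≋⟨ ⊕-cong (≋-trans (ΣS-cong (suc M) (λ k → ≋-sym (·-⋆ʳ (e k) Xs (dI k g)))) (≋-sym (⋆-ΣS (suc M) Xs (λ k → e k ·ₛ dI k g)))) (·-cong refl (≋-sym (OP-ext M (suc M) e b (ℕₚ.n≤1+n M)))) ⟩
    Xs ⋆ OP (suc M) e g ⊕ a ·ₛ OP (suc M) e g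
      ≋⟨ ⊕-cong ≋-refl (≋-sym (const-⋆ a _)) ⟩
    Xs ⋆ OP (suc M) e g ⊕ constS a ⋆ OP (suc M) e g
      ≋⟨ solveS 3 (λ x c p → x ⊠ p ⊞ c ⊠ p ≔ (c ⊞ x) ⊠ p) SRR.refl Xs (constS a) (OP (suc M) e g) ⟩
    lin a ⋆ OP (suc M) e g ∎≋
    where e = expS a

  taylor-mono : ∀ a i N → i ℕ.< N → powS (lin a) i ≋ OP N (expS a) (mono i)
  taylor-mono a zero N lt = ≋-sym (≋-trans (OP-ext 1 N (expS a) (Bnd-monomial 0) lt)
    (mk≋ λ n → trans (+-identityˡ _) (trans (*-congʳ (exp0 a)) (trans (*-identityˡ _) (trans (app (powS0 Xs) n) (app (≋-sym (powS0 (lin a))) n))))))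
  taylor-mono a (suc i) (suc M) (s≤s lt) = begin≋
    lin a ⋆ powS (lin a) i ≋⟨ ⋆-congʳ (lin a) (taylor-mono a i (suc M) (ℕₚ.m≤n⇒m≤1+n lt)) ⟩
    lin a ⋆ OP (suc M) (expS a) (mono i) ≋⟨ ≋-sym (taylor-step a M (Bnd-weaken lt (Bnd-monomial i))) ⟩
    OP (suc M) (expS a) (mono (suc i)) ∎≋

  comp : ℕ → Carrier → Series → Series
  comp N a f = ΣS N (λ i → f i ·ₛ powS (lin a) i)

  taylor : ∀ N a {f} → Bnd N f → comp N a f ≋ OP N (expS a) f
  taylor N a {f} b = ≋-sym (begin≋
    OP N (expS a) f ≋⟨ OP-cong N ≋-refl (expand N b) ⟩
    OP N (expS a) (ΣS N (λ i → f i ·ₛ mono i)) ≋⟨ OP-ΣS N (expS a) N _ ⟩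
    ΣS N (λ i → OP N (expS a) (f i ·ₛ mono i)) ≋⟨ ΣS-cong< N (λ i lt → ≋-trans (OP-· N (expS a) (f i) (mono i)) (·-cong refl (≋-sym (taylor-mono a i N lt)))) ⟩
    comp N a f ∎≋)

  ΣS-tri : ∀ M (H : ℕ → ℕ → Series) → ΣS M (λ k → ΣS (suc k) (λ i → H i (k ∸ i))) ≋ ΣS M (λ i → ΣS (M ∸ i) (H i))
  ΣS-tri M H = mk≋ λ n → Σ-tri M (λ i j → H i j n)

  Σ·ₛ : ∀ N (cf : ℕ → Carrier) P → Σ N cf ·ₛ P ≋ ΣS N (λ i → cf i ·ₛ P)
  Σ·ₛ N cf P = mk≋ λ n → Σ-*ʳ N (P n) cf

  Bnd-⋆ : ∀ A B {f g} → Bnd (suc A) f → Bnd B g → Bnd (A ℕ.+ B) (f ⋆ g)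
  Bnd-⋆ A B {f} {g} bf bg n le = Σ-zero (suc n) λ i i<n → go i (i ℕ.<? suc A)
    where
    go : ∀ i → Dec (i ℕ.< suc A) → f i * g (n ∸ i) ≈ 0#
    go i (yes lt) = trans (*-congˡ (bg (n ∸ i) (ℕₚ.≤-trans (ℕₚ.≤-reflexive (≡.sym (ℕₚ.m+n∸m≡n A B))) (ℕₚ.≤-trans (ℕₚ.∸-monoˡ-≤ A le) (ℕₚ.∸-monoʳ-≤ n (ℕₚ.≤-pred lt)))))) (zeroʳ _)
    go i (no nlt) = trans (*-congʳ (bf i (ℕₚ.≮⇒≥ nlt))) (zeroˡ _)

  comp-cong : ∀ M a {f g} → f ≋ g → comp M a f ≋ comp M a g
  comp-cong M a e = ΣS-cong M (λ i → ·-cong (app e i) ≋-refl)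

  comp-ext : ∀ A M a {f} → Bnd A f → A ℕ.≤ M → comp M a f ≋ comp A a f
  comp-ext A M a b le = ΣS-ext A M (λ i le' → mk≋ λ n → trans (*-congʳ (b i le')) (zeroˡ _)) le

  -- Substitution x ↦ x + a is multiplicative on polynomials (the degree bound
  -- M must cover the product).  The proof expands both sides into double sums
  -- over (i, j) and discards the terms with i + j beyond the degrees.
  comp-hom : ∀ A B M a {f g} → Bnd A f → Bnd B g → A ℕ.+ B ℕ.≤ M → comp M a (f ⋆ g) ≋ comp M a f ⋆ comp M a g
  comp-hom A B M a {f} {g} bf bg le = begin≋
    comp M a (f ⋆ g) ≋⟨ ΣS-cong M (λ k → Σ·ₛ (suc k) (λ i → f i * g (k ∸ i)) (powS L k)) ⟩
    ΣS M (λ k → ΣS (suc k) (λ i → (f i * g (k ∸ i)) ·ₛ powS L k))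
      ≋⟨ ΣS-cong M (λ k → ΣS-cong< (suc k) (λ i lt → ·-cong refl (≋-trans (reflexive≋ (≡.cong (powS L) (≡.sym (ℕₚ.m+[n∸m]≡n (ℕₚ.≤-pred lt))))) (powS-+ L i (k ∸ i))))) ⟩
    ΣS M (λ k → ΣS (suc k) (λ i → H i (k ∸ i))) ≋⟨ ΣS-tri M H ⟩
    ΣS M (λ i → ΣS (M ∸ i) (H i)) ≋⟨ ΣS-cong< M (λ i lt → ≋-sym (ΣS-ext (M ∸ i) M (λ j le' → Hz i j (ℕₚ.≤-trans le (ℕₚ.≤-trans (ℕₚ.m≤n+m∸n M i) (ℕₚ.+-monoʳ-≤ i le')))) (ℕₚ.m∸n≤m M i))) ⟩
    ΣS M (λ i → ΣS M (H i)) ≋⟨ ΣS-cong M (λ i → ΣS-cong M (λ j → ≋-trans (≋-sym (·-· (f i) (g j) _)) (≋-trans (·-cong {f i} refl (≋-sym (·-⋆ʳ (g j) (powS L i) (powS L j)))) (≋-sym (·-⋆ˡ (f i) (powS L i) (g j ·ₛ powS L j)))))) ⟩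
    ΣS M (λ i → ΣS M (λ j → (f i ·ₛ powS L i) ⋆ (g j ·ₛ powS L j))) ≋⟨ ΣS-cong M (λ i → ≋-sym (⋆-ΣS M (f i ·ₛ powS L i) (λ j → g j ·ₛ powS L j))) ⟩
    ΣS M (λ i → (f i ·ₛ powS L i) ⋆ comp M a g) ≋⟨ ≋-sym (ΣS-⋆ M (λ i → f i ·ₛ powS L i) (comp M a g)) ⟩
    comp M a f ⋆ comp M a g ∎≋
    where
    L = lin a
    H : ℕ → ℕ → Series
    H i j = (f i * g j) ·ₛ (powS L i ⋆ powS L j)
    Hz : ∀ i j → A ℕ.+ B ℕ.≤ i ℕ.+ j → H i j ≋ zeroS
    Hz i j le' with i ℕ.<? A
    ... | yes lt = mk≋ λ n → trans (*-congʳ (trans (*-congˡ (bg j (ℕₚ.+-cancelˡ-≤ A B j (ℕₚ.≤-trans le' (ℕₚ.+-monoˡ-≤ j (ℕₚ.<⇒≤ lt)))))) (zeroʳ _))) (zeroˡ _)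
    ... | no nlt = mk≋ λ n → trans (*-congʳ (trans (*-congʳ (bf i (ℕₚ.≮⇒≥ nlt))) (zeroˡ _))) (zeroˡ _)

  Bnd-one : Bnd 1 oneS
  Bnd-one zero ()
  Bnd-one (suc i) _ = refl

  comp-one : ∀ M a → 1 ℕ.≤ M → comp M a oneS ≋ oneS
  comp-one M a le = ≋-trans (comp-ext 1 M a Bnd-one le) (mk≋ λ n → trans (+-identityˡ _) (trans (*-identityˡ _) (app (powS0 (lin a)) n)))

  Bnd-powS : ∀ {q} → Bnd 2 q → ∀ k → Bnd (suc k) (powS q k)
  Bnd-powS b zero = Bnd-cong (≋-sym (powS0 _)) Bnd-one
  Bnd-powS b (suc k) = Bnd-⋆ 1 (suc k) b (Bnd-powS b k)

  comp-pow : ∀ M a {q} → Bnd 2 q → ∀ k → k ℕ.+ 2 ℕ.≤ M → comp M a (powS q k) ≋ powS (comp M a q) k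
  comp-pow M a {q} b zero le = ≋-trans (comp-cong M a (powS0 q)) (≋-trans (comp-one M a (ℕₚ.≤-trans (s≤s z≤n) le)) (≋-sym (powS0 _)))
  comp-pow M a {q} b (suc k) le = ≋-trans (comp-hom 2 (suc k) M a b (Bnd-powS b k) (ℕₚ.≤-trans (ℕₚ.≤-reflexive (ℕₚ.+-comm 2 (suc k))) le))
    (⋆-congʳ (comp M a q) (comp-pow M a b k (ℕₚ.≤-trans (ℕₚ.n≤1+n _) le)))

  binom-coef : ∀ b N m → powS (lin b) N m ≈ nat (N C m) * pow b (N ∸ m)
  binom-coef b zero zero = sym (trans (*-congʳ (+-identityʳ 1#)) (*-identityˡ _))
  binom-coef b zero (suc m) = sym (zeroˡ _)
  binom-coef b (suc N) m = trans (app (SRR.distribʳ (powS (lin b) N) (constS b) Xs) m)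
    (trans (+-cong (app (const-⋆ b (powS (lin b) N)) m) (app (Xs⋆ (powS (lin b) N)) m)) (go m))
    where
    Pb = powS (lin b) N
    go : ∀ m → b * Pb m + tS Pb m ≈ nat (suc N C m) * pow b (suc N ∸ m)
    go zero = trans (+-cong (*-congˡ (binom-coef b N 0)) refl) (solve 3 (λ x y o → x :* (o :* y) :+ con (+ 0) := o :* (x :* y)) refl b (pow b N) (nat 1))
    go (suc m') with m' ℕ.<? N
    ... | yes lt = begin
        b * Pb (suc m') + Pb m' ≈⟨ +-cong (*-congˡ (binom-coef b N (suc m'))) (binom-coef b N m') ⟩
        b * (nat (N C suc m') * pow b (N ∸ suc m')) + nat (N C m') * pow b (N ∸ m') ≈⟨ +-congˡ (*-congˡ (reflexive (≡.cong (pow b) (∸-suc N m' lt)))) ⟩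
        b * (nat (N C suc m') * pow b (N ∸ suc m')) + nat (N C m') * (b * pow b (N ∸ suc m')) ≈⟨ solve 4 (λ x c1 c0 p → x :* (c1 :* p) :+ c0 :* (x :* p) := (c0 :+ c1) :* (x :* p)) refl b (nat (N C suc m')) (nat (N C m')) _ ⟩
        (nat (N C m') + nat (N C suc m')) * (b * pow b (N ∸ suc m')) ≈⟨ *-cong (trans (sym (nat-+ (N C m') (N C suc m'))) (nat-cong (nCk+nC[k+1]≡[n+1]C[k+1] N m'))) (sym (reflexive (≡.cong (pow b) (∸-suc N m' lt)))) ⟩
        nat (suc N C suc m') * pow b (N ∸ m') ∎
    ... | no nlt = begin
        b * Pb (suc m') + Pb m' ≈⟨ +-cong (*-congˡ (binom-coef b N (suc m'))) (binom-coef b N m') ⟩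
        b * (nat (N C suc m') * pow b (N ∸ suc m')) + nat (N C m') * pow b (N ∸ m') ≈⟨ +-congʳ (trans (*-congˡ (trans (*-congʳ (nat-cong (Combinatorics.k>n⇒nCk≡0 (s≤s (ℕₚ.≮⇒≥ nlt))))) (zeroˡ _))) (zeroʳ _)) ⟩
        0# + nat (N C m') * pow b (N ∸ m') ≈⟨ +-identityˡ _ ⟩
        nat (N C m') * pow b (N ∸ m') ≈⟨ *-congʳ (nat-cong (≡.trans (≡.sym (ℕₚ.+-identityʳ (N C m'))) (≡.trans (≡.cong (N C m' ℕ.+_) (≡.sym (Combinatorics.k>n⇒nCk≡0 (s≤s (ℕₚ.≮⇒≥ nlt))))) (nCk+nC[k+1]≡[n+1]C[k+1] N m')))) ⟩
        nat (suc N C suc m') * pow b (N ∸ m') ∎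

  Bnd-lin : ∀ b → Bnd 2 (lin b)
  Bnd-lin b zero ()
  Bnd-lin b (suc zero) (s≤s ())
  Bnd-lin b (suc (suc i)) _ = +-identityʳ _

  Bnd-powlin : ∀ b N → Bnd (suc N) (powS (lin b) N)
  Bnd-powlin b N = Bnd-powS (Bnd-lin b) N

  binom-expand : ∀ b N → powS (lin b) N ≋ ΣS (suc N) (λ k → (nat (N C k) * pow b (N ∸ k)) ·ₛ mono k)
  binom-expand b N = ≋-trans (expand (suc N) (Bnd-powlin b N)) (ΣS-cong (suc N) (λ k → ·-cong (binom-coef b N k) ≋-refl))

  Σ-pick : ∀ M i (w h : ℕ → Carrier) → w i ≈ 1# → (∀ j → ¬ (j ≡ i) → w j ≈ 0#) → i ℕ.< M → Σ M (λ j → w j * h j) ≈ h i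
  Σ-pick (suc M) i w h wi wj lt with i ℕ.≟ M
  ... | yes ≡.refl = trans (+-cong (Σ-zero M (λ j j<M → trans (*-congʳ (wj j (λ e → ℕₚ.<-irrefl e j<M))) (zeroˡ _))) (trans (*-congʳ wi) (*-identityˡ _))) (+-identityˡ _)
  ... | no ne = trans (+-cong (Σ-pick M i w h wi wj (ℕₚ.≤∧≢⇒< (ℕₚ.≤-pred lt) ne)) (trans (*-congʳ (wj M (λ e → ne (≡.sym e)))) (zeroˡ _))) (+-identityʳ _)

  comp-mono : ∀ M a i → i ℕ.< M → comp M a (mono i) ≋ powS (lin a) i
  comp-mono M a i lt = mk≋ λ n → Σ-pick M i (mono i) (λ j → powS (lin a) j n) (mono-eq i) (λ j ne → mono-ne i j (λ e → ne (≡.sym e))) lt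

  comp-affine : ∀ M a {q} → Bnd 2 q → 2 ℕ.≤ M → comp M a q ≋ q 0 ·ₛ oneS ⊕ q 1 ·ₛ lin a
  comp-affine M a {q} b le = ≋-trans (comp-ext 2 M a b le) (mk≋ λ n → trans (+-cong (trans (+-identityˡ _) (*-congˡ (app (powS0 (lin a)) n))) (*-congˡ (app (⋆-congʳ (lin a) (powS0 (lin a))) n)))
    (+-congˡ (*-congˡ (app (SRR.*-identityʳ (lin a)) n))))

  negS-pow : ∀ f k → powS (negS f) k ≋ negS (powS f k)
  negS-pow f zero = ≋-trans (powS0 _) (≋-sym (≋-trans (negS-cong (powS0 f)) negS-one))
  negS-pow f (suc k) = ≋-trans (⋆-congʳ (negS f) (negS-pow f k)) (≋-sym (negS-⋆ f (powS f k)))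

  powS-· : ∀ a f k → powS (a ·ₛ f) k ≋ pow a k ·ₛ powS f k
  powS-· a f zero = mk≋ λ { zero → sym (*-identityˡ _) ; (suc n) → sym (*-identityˡ _) }
  powS-· a f (suc k) = ≋-trans (⋆-congʳ (a ·ₛ f) (powS-· a f k)) (≋-trans (·-⋆ˡ a f (pow a k ·ₛ powS f k)) (≋-trans (·-cong {a} refl (·-⋆ʳ (pow a k) f (powS f k))) (·-· a (pow a k) _)))

  -- This is
  -- where the sums on the left-hand side of the theorem come from.
  D-lemma : ∀ a b r lam →
    invℕ (r !) ·ₛ dI r (mono (a ℕ.+ r) ⋆ powS (lin lam) (b ℕ.+ r))
    ≋ ΣS (suc (b ℕ.+ r)) (λ k → (pow lam ((b ℕ.+ r) ∸ k) * (nat ((b ℕ.+ r) C k) * nat ((a ℕ.+ k ℕ.+ r) C r))) ·ₛ mono (a ℕ.+ k))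
  D-lemma a b r lam = begin≋
    inv ·ₛ dI r (mono Na ⋆ powS (lin lam) Nb) ≋⟨ ·-cong refl (dI-cong r (⋆-congʳ (mono Na) (binom-expand lam Nb))) ⟩
    inv ·ₛ dI r (mono Na ⋆ ΣS (suc Nb) (λ k → β k ·ₛ mono k)) ≋⟨ ·-cong refl (dI-cong r (≋-trans (⋆-ΣS (suc Nb) (mono Na) (λ k → β k ·ₛ mono k)) (ΣS-cong (suc Nb) (λ k → ≋-trans (·-⋆ʳ (β k) (mono Na) (mono k)) (·-cong refl (≋-sym (powS-+ Xs Na k))))))) ⟩
    inv ·ₛ dI r (ΣS (suc Nb) (λ k → β k ·ₛ mono (Na ℕ.+ k))) ≋⟨ ·-cong refl (≋-trans (dI-ΣS r (suc Nb) (λ k → β k ·ₛ mono (Na ℕ.+ k))) (ΣS-cong (suc Nb) (λ k → ≋-trans (dI-· r (β k) (mono (Na ℕ.+ k))) (·-cong refl (dI-mono r (Na ℕ.+ k)))))) ⟩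
    inv ·ₛ ΣS (suc Nb) (λ k → β k ·ₛ (nat (fallN (Na ℕ.+ k) r) ·ₛ mono (Na ℕ.+ k ∸ r))) ≋⟨ ΣS-· (suc Nb) inv (λ k → β k ·ₛ (nat (fallN (Na ℕ.+ k) r) ·ₛ mono (Na ℕ.+ k ∸ r))) ⟩
    ΣS (suc Nb) (λ k → inv ·ₛ (β k ·ₛ (nat (fallN (Na ℕ.+ k) r) ·ₛ mono (Na ℕ.+ k ∸ r)))) ≋⟨ ΣS-cong (suc Nb) term ⟩
    ΣS (suc Nb) (λ k → (pow lam (Nb ∸ k) * (nat (Nb C k) * nat ((a ℕ.+ k ℕ.+ r) C r))) ·ₛ mono (a ℕ.+ k)) ∎≋
    where
    Na = a ℕ.+ r
    Nb = b ℕ.+ r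
    inv = invℕ (r !)
    β : ℕ → Carrier
    β k = nat (Nb C k) * pow lam (Nb ∸ k)
    idx : ∀ k → Na ℕ.+ k ≡ a ℕ.+ k ℕ.+ r
    idx k = ≡.trans (ℕₚ.+-assoc a r k) (≡.trans (≡.cong (a ℕ.+_) (ℕₚ.+-comm r k)) (≡.sym (ℕₚ.+-assoc a k r)))
    term : ∀ k → inv ·ₛ (β k ·ₛ (nat (fallN (Na ℕ.+ k) r) ·ₛ mono (Na ℕ.+ k ∸ r)))
               ≋ (pow lam (Nb ∸ k) * (nat (Nb C k) * nat ((a ℕ.+ k ℕ.+ r) C r))) ·ₛ mono (a ℕ.+ k)
    term k = ≋-trans (≋-trans (·-cong {inv} refl (·-· (β k) (nat (fallN (Na ℕ.+ k) r)) (mono (Na ℕ.+ k ∸ r)))) (·-· inv (β k * nat (fallN (Na ℕ.+ k) r)) (mono (Na ℕ.+ k ∸ r)))) (·-cong scal (reflexive≋ (≡.cong mono (≡.trans (≡.cong (_∸ r) (idx k)) (ℕₚ.m+n∸n≡m (a ℕ.+ k) r)))))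
      where
      ck = nat ((a ℕ.+ k ℕ.+ r) C r)
      scal : inv * (β k * nat (fallN (Na ℕ.+ k) r)) ≈ pow lam (Nb ∸ k) * (nat (Nb C k) * ck)
      scal = begin
        inv * (β k * nat (fallN (Na ℕ.+ k) r)) ≈⟨ *-congˡ (*-congˡ (nat-cong (≡.trans (≡.cong (λ z → fallN z r) (idx k)) (≡.sym (C-fall (a ℕ.+ k ℕ.+ r) r))))) ⟩
        inv * (β k * nat (((a ℕ.+ k ℕ.+ r) C r) ℕ.* (r !))) ≈⟨ *-congˡ (*-congˡ (nat-* ((a ℕ.+ k ℕ.+ r) C r) (r !))) ⟩
        inv * ((nat (Nb C k) * pow lam (Nb ∸ k)) * (ck * nat (r !))) ≈⟨ solve 5 (λ i x p y f → i :* ((x :* p) :* (y :* f)) := p :* (x :* y) :* (i :* f)) refl inv (nat (Nb C k)) (pow lam (Nb ∸ k)) ck (nat (r !)) ⟩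
        (pow lam (Nb ∸ k) * (nat (Nb C k) * ck)) * (inv * nat (r !)) ≈⟨ *-congˡ (inv-l r) ⟩
        (pow lam (Nb ∸ k) * (nat (Nb C k) * ck)) * 1# ≈⟨ *-identityʳ _ ⟩
        pow lam (Nb ∸ k) * (nat (Nb C k) * ck) ∎

  Bnd-X : Bnd 2 Xs
  Bnd-X zero ()
  Bnd-X (suc zero) (s≤s ())
  Bnd-X (suc (suc i)) _ = refl

  comp-lin : ∀ M a b → 2 ℕ.≤ M → comp M a (lin b) ≋ lin (b + a)
  comp-lin M a b le = ≋-trans (comp-affine M a (Bnd-lin b) le) (mk≋ λ
    { zero → solve 2 (λ b a → (b :+ con (+ 0)) :* con (+ 1) :+ (con (+ 0) :+ con (+ 1)) :* (a :+ con (+ 0)) := (b :+ a) :+ con (+ 0)) refl b a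
    ; (suc zero) → solve 1 (λ b → (b :+ con (+ 0)) :* con (+ 0) :+ (con (+ 0) :+ con (+ 1)) :* (con (+ 0) :+ con (+ 1)) := con (+ 0) :+ con (+ 1)) refl b
    ; (suc (suc n)) → solve 1 (λ b → (b :+ con (+ 0)) :* con (+ 0) :+ (con (+ 0) :+ con (+ 1)) :* (con (+ 0) :+ con (+ 0)) := con (+ 0) :+ con (+ 0)) refl b })

  comp-negX : ∀ M a → 2 ℕ.≤ M → comp M a (negS Xs) ≋ m1 ·ₛ lin a
  comp-negX M a le = ≋-trans (comp-affine M a (Bnd-negS Bnd-X) le) (mk≋ λ
    { zero → solve 1 (λ a → (con (+ 1) :* con (+ 0)) :* con (+ 1) :+ ((:- con (+ 1)) :* con (+ 1)) :* con (+ 1) :* (a :+ con (+ 0)) := (:- con (+ 1)) :* (a :+ con (+ 0))) refl a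
    ; (suc zero) → solve 0 ((con (+ 1) :* con (+ 0)) :* con (+ 0) :+ ((:- con (+ 1)) :* con (+ 1)) :* con (+ 1) :* (con (+ 0) :+ con (+ 1)) := (:- con (+ 1)) :* (con (+ 0) :+ con (+ 1))) refl
    ; (suc (suc n)) → solve 0 ((con (+ 1) :* con (+ 0)) :* con (+ 0) :+ ((:- con (+ 1)) :* con (+ 1)) :* con (+ 1) :* (con (+ 0) :+ con (+ 0)) := (:- con (+ 1)) :* (con (+ 0) :+ con (+ 0))) refl })

  comp-neglin : ∀ M b t → 2 ℕ.≤ M → comp M (b + t) (negS (lin b)) ≋ m1 ·ₛ lin t
  comp-neglin M b t le = ≋-trans (comp-affine M (b + t) (Bnd-negS (Bnd-lin b)) le) (mk≋ λ
    { zero → solve 2 (λ b t → (con (+ 1) :* (b :+ con (+ 0))) :* con (+ 1) :+ ((:- con (+ 1)) :* con (+ 1)) :* (con (+ 0) :+ con (+ 1)) :* ((b :+ t) :+ con (+ 0)) := (:- con (+ 1)) :* (t :+ con (+ 0))) refl b t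
    ; (suc zero) → solve 1 (λ b → (con (+ 1) :* (b :+ con (+ 0))) :* con (+ 0) :+ ((:- con (+ 1)) :* con (+ 1)) :* (con (+ 0) :+ con (+ 1)) :* (con (+ 0) :+ con (+ 1)) := (:- con (+ 1)) :* (con (+ 0) :+ con (+ 1))) refl b
    ; (suc (suc n)) → solve 1 (λ b → (con (+ 1) :* (b :+ con (+ 0))) :* con (+ 0) :+ ((:- con (+ 1)) :* con (+ 1)) :* (con (+ 0) :+ con (+ 1)) :* (con (+ 0) :+ con (+ 0)) := (:- con (+ 1)) :* (con (+ 0) :+ con (+ 0))) refl b })

  OP-tS : ∀ N φ {f} → Bnd N f → OP N (tS φ) f ≋ OP N φ (dS f)
  OP-tS zero φ b = ≋-refl
  OP-tS (suc M) φ {f} b = begin≋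
    OP (suc M) (tS φ) f ≋⟨ ΣS-head M _ ⟩
    0# ·ₛ f ⊕ ΣS M (λ k → φ k ·ₛ dI (suc k) f) ≋⟨ ⊕-cong (mk≋ λ n → zeroˡ _) (ΣS-cong M (λ k → ·-cong refl (≋-sym (dI-dS k f)))) ⟩
    zeroS ⊕ OP M φ (dS f) ≋⟨ SRR.+-identityˡ _ ⟩
    OP M φ (dS f) ≋⟨ ≋-sym (OP-ext M (suc M) φ (Bnd-dI 1 b) (ℕₚ.n≤1+n M)) ⟩
    OP (suc M) φ (dS f) ∎≋

  OP-⊝φ : ∀ N φ f → OP N (⊝ φ) f ≋ ⊝ OP N φ f
  OP-⊝φ N φ f = ≋-trans (ΣS-cong N (λ k → mk≋ λ n → sym (-‿distribˡ-* _ _))) (ΣS-⊝ N _)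

  negS-OP : ∀ N ψ f → negS (OP N ψ f) ≋ OP N (negS ψ) (negS f)
  negS-OP N ψ f = ≋-sym (≋-trans (OP-negS N (negS ψ) f) (negS-cong (OP-cong N (negS-negS ψ) ≋-refl)))

  telescope : ∀ s (X : ℕ → Series) → ΣS s X ⊕ ⊝ ΣS s (λ j → X (suc j)) ≋ X 0 ⊕ ⊝ X s
  telescope zero X = mk≋ λ n → trans (+-congˡ -0#≈0#) (trans (+-identityʳ _) (sym (-‿inverseʳ _)))
  telescope (suc s) X = ≋-trans (solveS 4 (λ a b c d → (a ⊞ c) ⊞ ⊟ (b ⊞ d) ≔ (a ⊞ ⊟ b) ⊞ (c ⊞ ⊟ d)) SRR.refl (ΣS s X) (ΣS s (λ j → X (suc j))) (X s) (X (suc s)))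
    (≋-trans (⊕-congˡ (X s ⊕ ⊝ X (suc s)) (telescope s X))
    (solveS 3 (λ a b c → (a ⊞ ⊟ b) ⊞ (b ⊞ ⊟ c) ≔ a ⊞ ⊟ c) SRR.refl (X 0) (X s) (X (suc s))))

  -- The dictionary between coefficient lists (Poly of Defs) and series:
  -- cf turns each operation on Poly into the corresponding one on series.
  cf : Poly → Series
  cf = coeff

  coeff-+ₚ : ∀ p q → cf (p +ₚ q) ≋ cf p ⊕ cf q
  coeff-+ₚ [] q = mk≋ λ i → sym (+-identityˡ _)
  coeff-+ₚ (a ∷ p) [] = mk≋ λ i → sym (+-identityʳ _)
  coeff-+ₚ (a ∷ p) (b ∷ q) = mk≋ λ { zero → refl ; (suc i) → app (coeff-+ₚ p q) i }

  coeff-scale : ∀ a p → cf (scale a p) ≋ a ·ₛ cf p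
  coeff-scale a [] = mk≋ λ i → sym (zeroʳ _)
  coeff-scale a (b ∷ p) = mk≋ λ { zero → refl ; (suc i) → app (coeff-scale a p) i }

  coeff-sum : ∀ n f → cf (sumBelowP n f) ≋ ΣS n (λ j → cf (f j))
  coeff-sum zero f = mk≋ λ i → refl
  coeff-sum (suc n) f = ≋-trans (coeff-+ₚ (sumBelowP n f) (f n)) (⊕-congˡ (cf (f n)) (coeff-sum n f))

  coeff-cons : ∀ a p → cf (a ∷ p) ≋ constS a ⊕ Xs ⋆ cf p
  coeff-cons a p = mk≋ λ { zero → sym (trans (+-congˡ (app (Xs⋆ (cf p)) 0)) (+-identityʳ _))
                         ; (suc i) → sym (trans (+-congˡ (app (Xs⋆ (cf p)) (suc i))) (+-identityˡ _)) }

  coeff-* : ∀ p q → cf (p *ₚ q) ≋ cf p ⋆ cf q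
  coeff-* [] q = mk≋ λ n → sym (Σ-zero (suc n) (λ i _ → zeroˡ _))
  coeff-* (a ∷ p) q = begin≋
    cf (scale a q +ₚ (0# ∷ (p *ₚ q))) ≋⟨ coeff-+ₚ (scale a q) (0# ∷ (p *ₚ q)) ⟩
    cf (scale a q) ⊕ cf (0# ∷ (p *ₚ q)) ≋⟨ ⊕-cong (≋-trans (coeff-scale a q) (≋-sym (const-⋆ a (cf q)))) (≋-trans (coeff-cons 0# (p *ₚ q)) (⊕-cong const-0 (⋆-congʳ Xs (coeff-* p q)))) ⟩
    constS a ⋆ cf q ⊕ (zeroS ⊕ Xs ⋆ (cf p ⋆ cf q)) ≋⟨ solveS 4 (λ c q x p → c ⊠ q ⊞ (conS (+ 0) ⊞ x ⊠ (p ⊠ q)) ≔ (c ⊞ x ⊠ p) ⊠ q) SRR.refl (constS a) (cf q) Xs (cf p) ⟩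
    (constS a ⊕ Xs ⋆ cf p) ⋆ cf q ≋⟨ ⋆-congˡ (cf q) (≋-sym (coeff-cons a p)) ⟩
    cf (a ∷ p) ⋆ cf q ∎≋

  coeff-pow : ∀ p k → cf (powP p k) ≋ powS (cf p) k
  coeff-pow p zero = mk≋ λ { zero → refl ; (suc zero) → refl ; (suc (suc i)) → refl }
  coeff-pow p (suc k) = ≋-trans (coeff-* p (powP p k)) (⋆-congʳ (cf p) (coeff-pow p k))

  coeff-X : cf X ≋ Xs
  coeff-X = mk≋ λ { zero → refl ; (suc zero) → refl ; (suc (suc i)) → refl }

  coeff-mono : ∀ m → cf (monomial m) ≋ mono m
  coeff-mono m = ≋-trans (coeff-pow X m) (powS-cong m coeff-X)

  coeff-derivAux : ∀ k p i → cf (derivAux k p) i ≈ nat (k ℕ.+ i) * cf p i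
  coeff-derivAux k [] i = sym (zeroʳ _)
  coeff-derivAux k (a ∷ p) zero = *-congʳ (nat-cong (≡.sym (ℕₚ.+-identityʳ k)))
  coeff-derivAux k (a ∷ p) (suc i) = trans (coeff-derivAux (suc k) p i) (*-congʳ (nat-cong (≡.sym (ℕₚ.+-suc k i))))

  coeff-D : ∀ p → cf (D p) ≋ dS (cf p)
  coeff-D [] = mk≋ λ i → sym (zeroʳ _)
  coeff-D (a ∷ p) = mk≋ λ i → coeff-derivAux 1 p i

  coeff-Dpow : ∀ m p → cf (Dpow m p) ≋ dI m (cf p)
  coeff-Dpow zero p = ≋-refl
  coeff-Dpow (suc m) p = ≋-trans (coeff-D (Dpow m p)) (dS-cong (coeff-Dpow m p))

  Bnd-len : ∀ p → Bnd (length p) (cf p)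
  Bnd-len [] i _ = refl
  Bnd-len (a ∷ p) (suc i) (s≤s le) = Bnd-len p i le

  coeff-compose : ∀ p q → cf (compose p q) ≋ ΣS (length p) (λ i → cf p i ·ₛ powS (cf q) i)
  coeff-compose p q = ≋-trans (coeff-sum (length p) (λ i → scale (coeff p i) (powP q i))) (ΣS-cong (length p) (λ i → ≋-trans (coeff-scale (cf p i) (powP q i)) (·-cong refl (coeff-pow q i))))

  coeff-Ω : ∀ γ p → cf (Ω γ p) ≋ ΣS (length p) (λ i → cf p i ·ₛ cf (bernoulliGen γ i))
  coeff-Ω γ p = ≋-trans (coeff-sum (length p) (λ i → scale (coeff p i) (bernoulliGen γ i))) (ΣS-cong (length p) (λ i → coeff-scale (cf p i) (bernoulliGen γ i)))

  OP-ext2 : ∀ A M φ {f} → Bnd A f → Bnd M f → OP A φ f ≋ OP M φ f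
  OP-ext2 A M φ bA bM = ≋-trans (≋-sym (OP-ext A (A ℕ.+ M) φ bA (ℕₚ.m≤m+n A M))) (OP-ext M (A ℕ.+ M) φ bM (ℕₚ.m≤n+m M A))

  -- The generalized Bernoulli polynomial is an operator applied to a
  -- monomial: Bᵢ^(γ) = T^γ(D) xⁱ, because i!/(i-k)! xⁱ⁻ᵏ = Dᵏ xⁱ.
  B-operator : ∀ γ i → cf (bernoulliGen γ i) ≋ OP (suc i) (toddPow γ) (mono i)
  B-operator γ i = begin≋
    cf (bernoulliGen γ i) ≋⟨ ≋-trans (coeff-scale (nat (i !)) (sumBelowP (suc i) bt)) (·-cong refl (≋-trans (coeff-sum (suc i) bt) (ΣS-cong (suc i) (λ k → ≋-trans (coeff-scale (Tγ k * invℕ ((i ∸ k) !)) (monomial (i ∸ k))) (·-cong refl (coeff-mono (i ∸ k))))))) ⟩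
    nat (i !) ·ₛ ΣS (suc i) (λ k → (Tγ k * invℕ ((i ∸ k) !)) ·ₛ mono (i ∸ k)) ≋⟨ ΣS-· (suc i) _ _ ⟩
    ΣS (suc i) (λ k → nat (i !) ·ₛ ((Tγ k * invℕ ((i ∸ k) !)) ·ₛ mono (i ∸ k))) ≋⟨ ΣS-cong< (suc i) (λ k lt → ≋-trans (·-· (nat (i !)) _ _) (≋-trans (·-cong (scal k (ℕₚ.≤-pred lt)) ≋-refl) (≋-sym (·-· (Tγ k) _ _)))) ⟩
    ΣS (suc i) (λ k → Tγ k ·ₛ (nat (fallN i k) ·ₛ mono (i ∸ k))) ≋⟨ ΣS-cong (suc i) (λ k → ·-cong refl (≋-sym (dI-mono k i))) ⟩
    OP (suc i) Tγ (mono i) ∎≋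
    where
    Tγ = toddPow γ
    bt : ℕ → Poly
    bt k = scale (Tγ k * invℕ ((i ∸ k) !)) (monomial (i ∸ k))
    scal : ∀ k → k ℕ.≤ i → nat (i !) * (Tγ k * invℕ ((i ∸ k) !)) ≈ Tγ k * nat (fallN i k)
    scal k le = begin
      nat (i !) * (Tγ k * invℕ ((i ∸ k) !)) ≈⟨ *-congʳ (trans (nat-cong (≡.sym (fall-fact i k le))) (nat-* (fallN i k) ((i ∸ k) !))) ⟩
      (nat (fallN i k) * nat ((i ∸ k) !)) * (Tγ k * invℕ ((i ∸ k) !)) ≈⟨ solve 4 (λ f n t v → (f :* n) :* (t :* v) := (t :* f) :* (n :* v)) refl (nat (fallN i k)) (nat ((i ∸ k) !)) (Tγ k) (invℕ ((i ∸ k) !)) ⟩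
      (Tγ k * nat (fallN i k)) * (nat ((i ∸ k) !) * invℕ ((i ∸ k) !)) ≈⟨ *-congˡ (inv-r (i ∸ k)) ⟩
      (Tγ k * nat (fallN i k)) * 1# ≈⟨ *-identityʳ _ ⟩
      Tγ k * nat (fallN i k) ∎

  B-operator-ext : ∀ γ i M → i ℕ.< M → cf (bernoulliGen γ i) ≋ OP M (toddPow γ) (mono i)
  B-operator-ext γ i M lt = ≋-trans (B-operator γ i) (≋-sym (OP-ext (suc i) M (toddPow γ) (Bnd-monomial i) lt))

  Bnd-B : ∀ γ i → Bnd (suc i) (cf (bernoulliGen γ i))
  Bnd-B γ i = Bnd-cong (≋-sym (B-operator γ i)) (Bnd-OP (suc i) (toddPow γ) (Bnd-monomial i))

  Ω-as-operator : ∀ γ p M → Bnd M (cf p) → cf (Ω γ p) ≋ OP M (toddPow γ) (cf p)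
  Ω-as-operator γ p M b = begin≋
    cf (Ω γ p) ≋⟨ coeff-Ω γ p ⟩
    ΣS (length p) (λ i → cf p i ·ₛ cf (bernoulliGen γ i)) ≋⟨ ΣS-cong< (length p) (λ i lt → ·-cong refl (B-operator-ext γ i Kb (ℕₚ.<-≤-trans lt (ℕₚ.m≤m+n (length p) M)))) ⟩
    ΣS (length p) (λ i → cf p i ·ₛ OP Kb Tγ (mono i)) ≋⟨ ΣS-cong (length p) (λ i → ≋-sym (OP-· Kb Tγ (cf p i) (mono i))) ⟩
    ΣS (length p) (λ i → OP Kb Tγ (cf p i ·ₛ mono i)) ≋⟨ ≋-sym (OP-ΣS Kb Tγ (length p) _) ⟩
    OP Kb Tγ (ΣS (length p) (λ i → cf p i ·ₛ mono i)) ≋⟨ OP-cong Kb ≋-refl (≋-sym (expand (length p) (Bnd-len p))) ⟩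
    OP Kb Tγ (cf p) ≋⟨ OP-ext M Kb Tγ b (ℕₚ.m≤n+m M (length p)) ⟩
    OP M Tγ (cf p) ∎≋
    where
    Tγ = toddPow γ
    Kb = length p ℕ.+ M

  negS-ΣS : ∀ M G → negS (ΣS M G) ≋ ΣS M (λ j → negS (G j))
  negS-ΣS M G = mk≋ λ n → Σ-*ˡ M _ _

  negS-· : ∀ a f → negS (a ·ₛ f) ≋ a ·ₛ negS f
  negS-· a f = mk≋ λ n → solve 3 (λ p a x → p :* (a :* x) := a :* (p :* x)) refl _ a _

  cf-q : ∀ a → cf (constP a +ₚ scale (- 1#) X) ≋ negS (lin a)
  cf-q a = ≋-trans (coeff-+ₚ (constP a) (scale (- 1#) X)) (≋-trans (⊕-cong cfc (≋-trans (coeff-scale (- 1#) X) (·-cong refl coeff-X))) (mk≋ λ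
    { zero → solve 1 (λ a → a :+ (:- con (+ 1)) :* con (+ 0) := con (+ 1) :* (a :+ con (+ 0))) refl a
    ; (suc zero) → solve 0 (con (+ 0) :+ (:- con (+ 1)) :* con (+ 1) := ((:- con (+ 1)) :* con (+ 1)) :* (con (+ 0) :+ con (+ 1))) refl
    ; (suc (suc k)) → trans (+-cong refl (zeroʳ _)) (trans (+-identityˡ _) (sym (trans (*-congˡ (+-identityˡ _)) (zeroʳ _)))) }))
    where
    cfc : cf (constP a) ≋ constS a
    cfc = mk≋ λ { zero → refl ; (suc k) → refl }

  compose-as-operator : ∀ p a M → Bnd M (cf p) → cf (compose p (constP a +ₚ scale (- 1#) X)) ≋ negS (OP M (expS a) (cf p))
  compose-as-operator p a M b = begin≋
    cf (compose p q) ≋⟨ coeff-compose p q ⟩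
    ΣS (length p) (λ i → cf p i ·ₛ powS (cf q) i) ≋⟨ ΣS-cong (length p) (λ i → ·-cong refl (≋-trans (powS-cong i (cf-q a)) (negS-pow (lin a) i))) ⟩
    ΣS (length p) (λ i → cf p i ·ₛ negS (powS (lin a) i)) ≋⟨ ΣS-cong (length p) (λ i → ≋-sym (negS-· (cf p i) (powS (lin a) i))) ⟩
    ΣS (length p) (λ i → negS (cf p i ·ₛ powS (lin a) i)) ≋⟨ ≋-sym (negS-ΣS (length p) _) ⟩
    negS (comp (length p) a (cf p)) ≋⟨ negS-cong (taylor (length p) a (Bnd-len p)) ⟩
    negS (OP (length p) (expS a) (cf p)) ≋⟨ negS-cong (OP-ext2 (length p) M (expS a) (Bnd-len p) b) ⟩
    negS (OP M (expS a) (cf p)) ∎≋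
    where q = constP a +ₚ scale (- 1#) X

  cf-lin : ∀ a → cf (X +ₚ constP a) ≋ lin a
  cf-lin a = ≋-trans (coeff-+ₚ X (constP a)) (≋-trans (⊕-cong coeff-X cfc) (SRR.+-comm Xs (constS a)))
    where
    cfc : cf (constP a) ≋ constS a
    cfc = mk≋ λ { zero → refl ; (suc k) → refl }

  -- Both sides of the theorem equal
  -- T^α(D) H - T^α(D) (shiftH s).  All series involved have support below B,
  -- which serves as the cut-off of every operator.
  module Identity (α lam : Carrier) (l n r s : ℕ) where
    L N B : ℕ
    L = l ℕ.+ r
    N = n ℕ.+ r
    B = suc (suc (L ℕ.+ N))

    g₁ g₂ H H₂ : Series
    g₁ = mono L ⋆ powS (lin lam) N
    g₂ = mono N ⋆ powS (lin lam) L
    inv = invℕ (r !)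
    H = inv ·ₛ dI r g₁
    H₂ = inv ·ₛ dI r g₂
    Tα = toddPow α

    shiftH : ℕ → Series
    shiftH j = OP B (expS (- nat j)) H

    target : Series
    target = OP B Tα H ⊕ ⊝ OP B Tα (shiftH s)

    le₁ : suc L ℕ.+ suc N ℕ.≤ B
    le₁ = s≤s (ℕₚ.≤-reflexive (ℕₚ.+-suc L N))
    le₂ : suc N ℕ.+ suc L ℕ.≤ B
    le₂ = s≤s (ℕₚ.≤-reflexive (≡.trans (ℕₚ.+-suc N L) (≡.cong suc (ℕₚ.+-comm N L))))
    L<B : L ℕ.< B
    L<B = s≤s (ℕₚ.≤-trans (ℕₚ.m≤m+n L N) (ℕₚ.n≤1+n _))
    N+2≤B : N ℕ.+ 2 ℕ.≤ B
    N+2≤B = ℕₚ.≤-trans (ℕₚ.≤-reflexive (ℕₚ.+-comm N 2)) (s≤s (s≤s (ℕₚ.m≤n+m N L)))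
    L+2≤B : L ℕ.+ 2 ℕ.≤ B
    L+2≤B = ℕₚ.≤-trans (ℕₚ.≤-reflexive (ℕₚ.+-comm L 2)) (s≤s (s≤s (ℕₚ.m≤m+n L N)))
    2≤B : 2 ℕ.≤ B
    2≤B = s≤s (s≤s z≤n)

    Bg₁ : Bnd B g₁
    Bg₁ = Bnd-weaken (ℕₚ.≤-trans (ℕₚ.≤-reflexive (ℕₚ.+-suc L N)) (ℕₚ.n≤1+n _)) (Bnd-⋆ L (suc N) (Bnd-monomial L) (Bnd-powlin lam N))
    Bg₂ : Bnd B g₂
    Bg₂ = Bnd-weaken (ℕₚ.≤-trans (ℕₚ.≤-reflexive (≡.trans (ℕₚ.+-suc N L) (≡.cong suc (ℕₚ.+-comm N L)))) (ℕₚ.n≤1+n _)) (Bnd-⋆ N (suc L) (Bnd-monomial N) (Bnd-powlin lam L))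
    BH : Bnd B H
    BH = Bnd-· inv (Bnd-dI-≤ r Bg₁)
    BH₂ : Bnd B H₂
    BH₂ = Bnd-· inv (Bnd-dI-≤ r Bg₂)

    G : Carrier → Series
    G a = powS (lin a) L ⋆ powS (lin (lam + a)) N

    G-as-shift : ∀ a → G a ≋ OP B (expS a) g₁
    G-as-shift a = ≋-sym (begin≋
      OP B (expS a) g₁ ≋⟨ ≋-sym (taylor B a Bg₁) ⟩
      comp B a g₁ ≋⟨ comp-hom (suc L) (suc N) B a (Bnd-monomial L) (Bnd-powlin lam N) le₁ ⟩
      comp B a (mono L) ⋆ comp B a (powS (lin lam) N) ≋⟨ ⋆-cong (comp-mono B a L L<B) (≋-trans (comp-pow B a (Bnd-lin lam) N N+2≤B) (powS-cong N (comp-lin B a lam 2≤B))) ⟩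
      G a ∎≋)

    -- The right-hand side: its argument is (1/r!) D^{r+1} Σ_{1≤j≤s} G(-j),
    -- i.e. D applied to the sum of shifts shiftH 1 + … + shiftH s.

    shiftSum : Series
    shiftSum = ΣS s (λ j → shiftH (suc j))

    BshiftSum : Bnd B shiftSum
    BshiftSum = Bnd-ΣS s _ (λ j → Bnd-OP B _ BH)

    Gpoly : ℕ → Poly
    Gpoly j = powP (X +ₚ constP (- nat (suc j))) L *ₚ powP (X +ₚ constP (lam - nat (suc j))) N

    rhs-argument : Poly
    rhs-argument = scale inv (Dpow (suc r) (sumBelowP s Gpoly))

    rhs-argument-series : cf rhs-argument ≋ inv ·ₛ dI (suc r) (ΣS s (λ j → G (- nat (suc j))))
    rhs-argument-series = ≋-trans (coeff-scale inv (Dpow (suc r) (sumBelowP s Gpoly))) (·-cong refl (≋-trans (coeff-Dpow (suc r) (sumBelowP s Gpoly)) (dI-cong (suc r) (≋-trans (coeff-sum s Gpoly)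
      (ΣS-cong s (λ j → ≋-trans (coeff-* (powP (qa j) L) (powP (qb j) N)) (⋆-cong (≋-trans (coeff-pow (qa j) L) (powS-cong L (cf-lin (- nat (suc j))))) (≋-trans (coeff-pow (qb j) N) (powS-cong N (cf-lin (lam - nat (suc j))))))))))))
      where
      qa qb : ℕ → Poly
      qa j = X +ₚ constP (- nat (suc j))
      qb j = X +ₚ constP (lam - nat (suc j))

    rhs-derivative : inv ·ₛ dI (suc r) (ΣS s (λ j → G (- nat (suc j)))) ≋ dS shiftSum
    rhs-derivative = begin≋
      inv ·ₛ dS (dI r (ΣS s (λ j → G (- nat (suc j))))) ≋⟨ ≋-sym (dS-· inv (dI r (ΣS s (λ j → G (- nat (suc j)))))) ⟩
      dS (inv ·ₛ dI r (ΣS s (λ j → G (- nat (suc j))))) ≋⟨ dS-cong (·-cong refl (≋-trans (dI-ΣS r s _) (ΣS-cong s (λ j → ≋-trans (dI-cong r (G-as-shift (- nat (suc j)))) (OP-dI r B _ g₁))))) ⟩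
      dS (inv ·ₛ ΣS s (λ j → OP B (expS (- nat (suc j))) (dI r g₁))) ≋⟨ dS-cong (≋-trans (ΣS-· s inv _) (ΣS-cong s (λ j → ≋-sym (OP-· B _ inv (dI r g₁))))) ⟩
      dS shiftSum ∎≋

    shiftH-0 : shiftH 0 ≋ H
    shiftH-0 = ≋-trans (OP-cong B (≋-trans (expS-cong -0#≈0#) exp-zero) ≋-refl) (OP-one B BH)

    shiftH-step : ∀ j → OP B e1 (shiftH (suc j)) ≋ shiftH j
    shiftH-step j = ≋-trans (OP-comp B e1 _ BH) (OP-cong B (≋-trans (exp-add 1# (- nat (suc j))) (expS-cong one-minus)) ≋-refl)
      where
      one-minus : 1# + - nat (suc j) ≈ - nat j
      one-minus = solve 1 (λ x → con (+ 1) :+ :- (con (+ 1) :+ x) := :- x) refl (nat j)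

    -- T^{α-1}(D) D = T^α(D) (E D) = T^α(D) (e^D - 1), and the sum telescopes
    rhs-telescope : OP B (toddPow (α - 1#)) (dS shiftSum) ≋ target
    rhs-telescope = begin≋
      OP B (toddPow (α - 1#)) (dS shiftSum) ≋⟨ OP-cong B (≋-sym (P-shift α)) ≋-refl ⟩
      OP B (Tα ⋆ E) (dS shiftSum) ≋⟨ ≋-sym (OP-comp B Tα E (Bnd-dS BshiftSum)) ⟩
      OP B Tα (OP B E (dS shiftSum)) ≋⟨ OP-cong B ≋-refl (≋-trans (≋-sym (OP-tS B E BshiftSum)) (OP-cong B tS-E ≋-refl)) ⟩
      OP B Tα (OP B (e1 ⊕ ⊝ oneS) shiftSum) ≋⟨ OP-cong B ≋-refl (≋-trans (OP-⊕φ B e1 (⊝ oneS) shiftSum) (⊕-congʳ (OP B e1 shiftSum) (≋-trans (OP-⊝φ B oneS shiftSum) (SRR.-‿cong (OP-one B BshiftSum))))) ⟩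
      OP B Tα (OP B e1 shiftSum ⊕ ⊝ shiftSum) ≋⟨ OP-cong B ≋-refl (⊕-congˡ (⊝ shiftSum) (≋-trans (OP-ΣS B e1 s _) (ΣS-cong s shiftH-step))) ⟩
      OP B Tα (ΣS s shiftH ⊕ ⊝ shiftSum) ≋⟨ OP-cong B ≋-refl (≋-trans (telescope s shiftH) (⊕-congˡ (⊝ shiftH s) shiftH-0)) ⟩
      OP B Tα (H ⊕ ⊝ shiftH s) ≋⟨ ≋-trans (OP-⊕ B Tα H (⊝ shiftH s)) (⊕-congʳ (OP B Tα H) (OP-⊝ B Tα (shiftH s))) ⟩
      target ∎≋

    rhs-series : cf (rhs α lam l n r s) ≋ target
    rhs-series = begin≋
      cf (Ω (α - 1#) rhs-argument) ≋⟨ Ω-as-operator (α - 1#) rhs-argument B (Bnd-cong (≋-sym (≋-trans rhs-argument-series rhs-derivative)) (Bnd-dS BshiftSum)) ⟩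
      OP B (toddPow (α - 1#)) (cf rhs-argument) ≋⟨ OP-cong B ≋-refl (≋-trans rhs-argument-series rhs-derivative) ⟩
      OP B (toddPow (α - 1#)) (dS shiftSum) ≋⟨ rhs-telescope ⟩
      target ∎≋

    cA : ℕ → Carrier
    cA k = pow lam (N ∸ k) * (nat (N C k) * nat ((l ℕ.+ k ℕ.+ r) C r))

    firstTerm : ℕ → Poly
    firstTerm k = scale (cA k) (bernoulliGen α (l ℕ.+ k))

    l+k<B : ∀ k → k ℕ.< suc N → l ℕ.+ k ℕ.< B
    l+k<B k lt = s≤s (ℕₚ.≤-trans (ℕₚ.+-monoʳ-≤ l (ℕₚ.≤-pred lt)) (ℕₚ.≤-trans (ℕₚ.+-monoˡ-≤ N (ℕₚ.m≤m+n l r)) (ℕₚ.n≤1+n _)))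

    first-sum : cf (sumBelowP (suc N) firstTerm) ≋ OP B Tα H
    first-sum = begin≋
      cf (sumBelowP (suc N) firstTerm) ≋⟨ coeff-sum (suc N) firstTerm ⟩
      ΣS (suc N) (λ k → cf (firstTerm k)) ≋⟨ ΣS-cong< (suc N) (λ k lt → ≋-trans (coeff-scale (cA k) (bernoulliGen α (l ℕ.+ k))) (≋-trans (·-cong refl (B-operator-ext α (l ℕ.+ k) B (l+k<B k lt))) (≋-sym (OP-· B Tα (cA k) (mono (l ℕ.+ k)))))) ⟩
      ΣS (suc N) (λ k → OP B Tα (cA k ·ₛ mono (l ℕ.+ k))) ≋⟨ ≋-sym (OP-ΣS B Tα (suc N) _) ⟩
      OP B Tα (ΣS (suc N) (λ k → cA k ·ₛ mono (l ℕ.+ k))) ≋⟨ OP-cong B ≋-refl (≋-sym (D-lemma l n r lam)) ⟩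
      OP B Tα H ∎≋

    -- The second sum on the left-hand side is, by D-lemma and compose-as-operator,
    -- the reflection x ↦ -x of e^{c₀ D} T^α(D) H₂ with c₀ = α + s - λ.  By
    -- P-reflection, this is (up to the sign κ) T^α(D) e^{(λ-s)D} H₂(-x), and
    -- Taylor's formula identifies e^{(λ-s)D} H₂(-x) with ± shiftH s.

    c₀ : Carrier
    c₀ = α + nat s - lam

    σ : Carrier
    σ = pow m1 N * pow m1 L

    κ : Carrier
    κ = pow m1 r * σ

    reflected-g₂ : OP B (expS (lam + - nat s)) (negS g₂) ≋ σ ·ₛ OP B (expS (- nat s)) g₁
    reflected-g₂ = begin≋
      OP B (expS a) (negS g₂) ≋⟨ ≋-sym (taylor B a (Bnd-negS Bg₂)) ⟩
      comp B a (negS g₂) ≋⟨ comp-cong B a (≋-trans (negS-⋆ (mono N) (powS (lin lam) L)) (≋-sym (⋆-cong (negS-pow Xs N) (negS-pow (lin lam) L)))) ⟩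
      comp B a (powS (negS Xs) N ⋆ powS (negS (lin lam)) L) ≋⟨ comp-hom (suc N) (suc L) B a (Bnd-powS (Bnd-negS Bnd-X) N) (Bnd-powS (Bnd-negS (Bnd-lin lam)) L) le₂ ⟩
      comp B a (powS (negS Xs) N) ⋆ comp B a (powS (negS (lin lam)) L) ≋⟨ ⋆-cong (comp-pow B a (Bnd-negS Bnd-X) N N+2≤B) (comp-pow B a (Bnd-negS (Bnd-lin lam)) L L+2≤B) ⟩
      powS (comp B a (negS Xs)) N ⋆ powS (comp B a (negS (lin lam))) L ≋⟨ ⋆-cong (powS-cong N (comp-negX B a 2≤B)) (powS-cong L (comp-neglin B lam (- nat s) 2≤B)) ⟩
      powS (m1 ·ₛ lin a) N ⋆ powS (m1 ·ₛ lin (- nat s)) L ≋⟨ ⋆-cong (powS-· m1 (lin a) N) (powS-· m1 (lin (- nat s)) L) ⟩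
      (pow m1 N ·ₛ powS (lin a) N) ⋆ (pow m1 L ·ₛ powS (lin (- nat s)) L) ≋⟨ ≋-trans (·-⋆ˡ (pow m1 N) (powS (lin a) N) (pow m1 L ·ₛ powS (lin (- nat s)) L)) (≋-trans (·-cong {pow m1 N} refl (·-⋆ʳ (pow m1 L) (powS (lin a) N) (powS (lin (- nat s)) L))) (·-· (pow m1 N) (pow m1 L) (powS (lin a) N ⋆ powS (lin (- nat s)) L))) ⟩
      σ ·ₛ (powS (lin a) N ⋆ powS (lin (- nat s)) L) ≋⟨ ·-cong refl (≋-trans (⋆-comm (powS (lin a) N) (powS (lin (- nat s)) L)) (G-as-shift (- nat s))) ⟩
      σ ·ₛ OP B (expS (- nat s)) g₁ ∎≋
      where a = lam + - nat s

    reflected-H₂ : negS H₂ ≋ (inv * pow m1 r) ·ₛ dI r (negS g₂)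
    reflected-H₂ = mk≋ λ k → begin
      pow m1 k * (inv * dI r g₂ k) ≈⟨ solve 3 (λ p i d → p :* (i :* d) := i :* (p :* d)) refl (pow m1 k) inv (dI r g₂ k) ⟩
      inv * (pow m1 k * dI r g₂ k) ≈⟨ *-congˡ (sym (trans (*-congˡ (app (dI-negS r g₂) k)) (trans (sym (*-assoc _ _ _)) (trans (*-congʳ (m1-sq r)) (*-identityˡ _))))) ⟩
      inv * (pow m1 r * dI r (negS g₂) k) ≈⟨ sym (*-assoc _ _ _) ⟩
      (inv * pow m1 r) * dI r (negS g₂) k ∎

    shifted-reflected-H₂ : OP B (expS (lam + - nat s)) (negS H₂) ≋ κ ·ₛ shiftH s
    shifted-reflected-H₂ = begin≋
      OP B ea (negS H₂) ≋⟨ OP-cong B ≋-refl reflected-H₂ ⟩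
      OP B ea ((inv * pow m1 r) ·ₛ dI r (negS g₂)) ≋⟨ ≋-trans (OP-· B ea _ _) (·-cong refl (≋-sym (OP-dI r B ea (negS g₂)))) ⟩
      (inv * pow m1 r) ·ₛ dI r (OP B ea (negS g₂)) ≋⟨ ·-cong refl (dI-cong r reflected-g₂) ⟩
      (inv * pow m1 r) ·ₛ dI r (σ ·ₛ OP B (expS (- nat s)) g₁) ≋⟨ ·-cong refl (≋-trans (dI-· r σ _) (·-cong refl (OP-dI r B _ g₁))) ⟩
      (inv * pow m1 r) ·ₛ (σ ·ₛ OP B (expS (- nat s)) (dI r g₁)) ≋⟨ mk≋ (λ k → solve 4 (λ i p q x → (i :* p) :* (q :* x) := (p :* q) :* (i :* x)) refl inv (pow m1 r) σ _) ⟩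
      κ ·ₛ (inv ·ₛ OP B (expS (- nat s)) (dI r g₁)) ≋⟨ ·-cong refl (≋-sym (OP-· B _ inv (dI r g₁))) ⟩
      κ ·ₛ shiftH s ∎≋
      where ea = expS (lam + - nat s)

    reflected-symbol : negS (expS c₀ ⋆ Tα) ≋ Tα ⋆ expS (lam + - nat s)
    reflected-symbol = begin≋
      negS (expS c₀ ⋆ Tα) ≋⟨ negS-⋆ (expS c₀) Tα ⟩
      negS (expS c₀) ⋆ negS Tα ≋⟨ ⋆-cong (negS-exp c₀) (P-reflection α) ⟩
      expS (- c₀) ⋆ (expS α ⋆ Tα) ≋⟨ SRR.sym (SRR.*-assoc (expS (- c₀)) (expS α) Tα) ⟩
      (expS (- c₀) ⋆ expS α) ⋆ Tα ≋⟨ ⋆-congˡ Tα (≋-trans (exp-add (- c₀) α) (expS-cong exponent)) ⟩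
      expS (lam + - nat s) ⋆ Tα ≋⟨ ⋆-comm _ Tα ⟩
      Tα ⋆ expS (lam + - nat s) ∎≋
      where
      exponent : - c₀ + α ≈ lam + - nat s
      exponent = solve 3 (λ a s l → :- (a :+ s :- l) :+ a := l :+ :- s) refl α (nat s) lam

    reflected-operator : negS (OP B (expS c₀) (OP B Tα H₂)) ≋ κ ·ₛ OP B Tα (shiftH s)
    reflected-operator = begin≋
      negS (OP B (expS c₀) (OP B Tα H₂)) ≋⟨ negS-cong (OP-comp B (expS c₀) Tα BH₂) ⟩
      negS (OP B (expS c₀ ⋆ Tα) H₂) ≋⟨ negS-OP B _ H₂ ⟩
      OP B (negS (expS c₀ ⋆ Tα)) (negS H₂) ≋⟨ OP-cong B reflected-symbol ≋-refl ⟩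
      OP B (Tα ⋆ expS (lam + - nat s)) (negS H₂) ≋⟨ ≋-sym (OP-comp B Tα _ (Bnd-negS BH₂)) ⟩
      OP B Tα (OP B (expS (lam + - nat s)) (negS H₂)) ≋⟨ OP-cong B ≋-refl shifted-reflected-H₂ ⟩
      OP B Tα (κ ·ₛ shiftH s) ≋⟨ OP-· B Tα κ (shiftH s) ⟩
      κ ·ₛ OP B Tα (shiftH s) ∎≋

    cB : ℕ → Carrier
    cB k = pow lam (L ∸ k) * (nat (L C k) * nat ((n ℕ.+ k ℕ.+ r) C r))

    secondTerm : ℕ → Poly
    secondTerm k = scale (cB k) (compose (bernoulliGen α (n ℕ.+ k)) (constP c₀ +ₚ scale (- 1#) X))

    n+k<B : ∀ k → k ℕ.< suc L → n ℕ.+ k ℕ.< B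
    n+k<B k lt = s≤s (ℕₚ.≤-trans (ℕₚ.+-monoʳ-≤ n (ℕₚ.≤-pred lt)) (ℕₚ.≤-trans (ℕₚ.≤-reflexive (ℕₚ.+-comm n L)) (ℕₚ.≤-trans (ℕₚ.+-monoʳ-≤ L (ℕₚ.m≤m+n n r)) (ℕₚ.n≤1+n _))))

    second-sum : cf (sumBelowP (suc L) secondTerm) ≋ negS (OP B (expS c₀) (OP B Tα H₂))
    second-sum = begin≋
      cf (sumBelowP (suc L) secondTerm) ≋⟨ coeff-sum (suc L) secondTerm ⟩
      ΣS (suc L) (λ k → cf (secondTerm k)) ≋⟨ ΣS-cong< (suc L) (λ k lt → ≋-trans (coeff-scale (cB k) (compose (bernoulliGen α (n ℕ.+ k)) (constP c₀ +ₚ scale (- 1#) X))) (·-cong refl (≋-trans (compose-as-operator (bernoulliGen α (n ℕ.+ k)) c₀ B (Bnd-weaken (n+k<B k lt) (Bnd-B α (n ℕ.+ k)))) (negS-cong (OP-cong B ≋-refl (B-operator-ext α (n ℕ.+ k) B (n+k<B k lt))))))) ⟩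
      ΣS (suc L) (λ k → cB k ·ₛ negS (OP B (expS c₀) (OP B Tα (mono (n ℕ.+ k))))) ≋⟨ ΣS-cong (suc L) (λ k → ≋-trans (≋-sym (negS-· (cB k) _)) (negS-cong (≋-trans (≋-sym (OP-· B (expS c₀) (cB k) _)) (OP-cong B ≋-refl (≋-sym (OP-· B Tα (cB k) (mono (n ℕ.+ k)))))))) ⟩
      ΣS (suc L) (λ k → negS (OP B (expS c₀) (OP B Tα (cB k ·ₛ mono (n ℕ.+ k))))) ≋⟨ ≋-sym (≋-trans (negS-cong (≋-trans (OP-cong B ≋-refl (OP-ΣS B Tα (suc L) _)) (OP-ΣS B (expS c₀) (suc L) _))) (negS-ΣS (suc L) _)) ⟩
      negS (OP B (expS c₀) (OP B Tα (ΣS (suc L) (λ k → cB k ·ₛ mono (n ℕ.+ k))))) ≋⟨ negS-cong (OP-cong B ≋-refl (OP-cong B ≋-refl (≋-sym (D-lemma n l r lam)))) ⟩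
      negS (OP B (expS c₀) (OP B Tα H₂)) ∎≋

    sgn : Carrier
    sgn = pow m1 (l ℕ.+ n ℕ.+ r ℕ.+ 1)

    sgn-κ : sgn * κ ≈ - 1#
    sgn-κ = begin
      sgn * κ ≈⟨ *-cong (trans (pow-+ m1 (l ℕ.+ n ℕ.+ r) 1) (*-congʳ (trans (pow-+ m1 (l ℕ.+ n) r) (*-congʳ (pow-+ m1 l n)))))
                       (*-congˡ (*-cong (pow-+ m1 n r) (pow-+ m1 l r))) ⟩
      (((pl * pn) * pr) * (m1 * 1#)) * (pr * ((pn * pr) * (pl * pr))) ≈⟨ solve 3 (λ a b c → (((a :* b) :* c) :* ((:- con (+ 1)) :* con (+ 1))) :* (c :* ((b :* c) :* (a :* c))) := (:- con (+ 1)) :* ((a :* a) :* ((b :* b) :* ((c :* c) :* (c :* c))))) refl pl pn pr ⟩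
      m1 * ((pl * pl) * ((pn * pn) * ((pr * pr) * (pr * pr)))) ≈⟨ *-congˡ (*-cong (m1-sq l) (*-cong (m1-sq n) (*-cong (m1-sq r) (m1-sq r)))) ⟩
      m1 * (1# * (1# * (1# * 1#))) ≈⟨ solve 0 ((:- con (+ 1)) :* (con (+ 1) :* (con (+ 1) :* (con (+ 1) :* con (+ 1)))) := :- con (+ 1)) refl ⟩
      - 1# ∎
      where
      pl = pow m1 l
      pn = pow m1 n
      pr = pow m1 r

    lhs-series : cf (lhs α lam l n r s) ≋ target
    lhs-series = begin≋
      cf (lhs α lam l n r s) ≋⟨ coeff-+ₚ (sumBelowP (suc N) firstTerm) (scale sgn (sumBelowP (suc L) secondTerm)) ⟩
      cf (sumBelowP (suc N) firstTerm) ⊕ cf (scale sgn (sumBelowP (suc L) secondTerm)) ≋⟨ ⊕-cong first-sum (≋-trans (coeff-scale sgn (sumBelowP (suc L) secondTerm)) (·-cong refl second-sum)) ⟩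
      OP B Tα H ⊕ sgn ·ₛ negS (OP B (expS c₀) (OP B Tα H₂)) ≋⟨ ⊕-congʳ (OP B Tα H) (≋-trans (·-cong refl reflected-operator) (≋-trans (·-· sgn κ _) (≋-trans (·-cong sgn-κ ≋-refl) (mk≋ λ k → trans (sym (-‿distribˡ-* _ _)) (-‿cong (*-identityˡ _)))))) ⟩
      target ∎≋


mainTheorem1 : ∀ {c ℓ : Level} (F : CharZeroField c ℓ) (α lam : CharZeroField.Carrier F) (l n r s : ℕ) →
    WithField._≈ₚ_ F (WithField.lhs F α lam l n r s) (WithField.rhs F α lam l n r s)
mainTheorem1 F α lam l n r s = app (≋-trans lhs-series (≋-sym rhs-series))
  where
  open Theory F
  open Identity α lam l n r s
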